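{- Let $\gamma=(1+\sqrt5)/2$ be the golden ratio. For each $n$, place $t$ indistinguishable pebbles on the vertices of the complete graph $K_n$ according to the Bose Einstein scheme. Let $\varphi(n)\to\infty$ be arbitrary. If $t=\gamma n+\varphi(n)\sqrt n$, then $\mathbb{P}(K_n \text{ is cover solvable})\to 1$ as $n\to\infty$; and if $t=\gamma n-\varphi(n)\sqrt n$, then $\mathbb{P}(K_n \text{ is cover solvable})\to 0$ as $n\to\infty$.
   Context: A configuration on a graph $G$ is a function $C:V(G)\to\mathbb{N}\cup\{0\}$ giving the number of pebbles on each vertex. A pebbling move removes two pebbles from some vertex and places one pebble on an adjacent vertex. A configuration is cover solvable if some finite sequence of (legal) pebbling moves results in at least one pebble on every vertex simultaneously; "$K_n$ is cover solvable" means the random configuration is cover solvable. In the Bose Einstein scheme the pebbles are indistinguishable and each of the $\binom{n+t-1}{n-1}$ configurations of $t$ pebbles on the $n$ vertices is equally likely. -}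

module Defs where

open import Data.Nat as ℕ using (ℕ; zero; suc; _≤_; _*_)
open import Data.Nat.Combinatorics using (_C_)
open import Data.Integer as ℤ using (ℤ; +_; -_; 0ℤ)
open import Data.Fin using (Fin)
open import Data.Vec using (Vec; lookup; _[_]%=_; sum)
open import Data.Vec.Relation.Unary.All as VAll using ()
open import Data.List using (List; length)
open import Data.List.Relation.Unary.All as LAll using ()
open import Data.List.Relation.Unary.Unique.Propositional using (Unique)
open import Data.Product using (Σ; ∃; _×_)
open import Data.Sum using (_⊎_)
open import Relation.Binary.PropositionalEquality using (_≡_; _≢_)
open import Relation.Binary.Construct.Closure.ReflexiveTransitive using (Star)
open import Relation.Nullary using (¬_)

-- Pebbling on the complete graph K_n (vertex set Fin n, every two
-- distinct vertices adjacent).  A configuration is a Vec ℕ n.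

data Move {n : ℕ} : Vec ℕ n → Vec ℕ n → Set where
  move : (c : Vec ℕ n) (i j : Fin n) → i ≢ j → 2 ≤ lookup c i →
         Move c ((c [ i ]%= (ℕ._∸ 2)) [ j ]%= suc)

Reachable : {n : ℕ} → Vec ℕ n → Vec ℕ n → Set
Reachable = Star Move

CoverSolvable : {n : ℕ} → Vec ℕ n → Set
CoverSolvable c = ∃ λ D → Reachable c D × VAll.All (λ x → 1 ≤ x) D

-- Bose–Einstein probabilities.  The sample space is the set of
-- configurations C : Vec ℕ n with sum C ≡ t, of size (n+t-1 choose n-1),
-- all equally likely.

total : ℕ → ℕ → ℕ
total n t = (n ℕ.+ t ℕ.∸ 1) C (n ℕ.∸ 1)

-- "P(K_n with t pebbles is cover solvable) ≥ k/(k+1)": there are at least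
-- k/(k+1)·total distinct cover-solvable configurations of t pebbles.
ProbSolvableAtLeast : (k n t : ℕ) → Set
ProbSolvableAtLeast k n t =
  Σ (List (Vec ℕ n)) λ L →
    Unique L ×
    LAll.All (λ c → sum c ≡ t × CoverSolvable c) L ×
    k * total n t ≤ suc k * length L

-- "P(K_n with t pebbles is cover solvable) ≤ 1/(k+1)": there are at least
-- k/(k+1)·total distinct configurations of t pebbles that are NOT
-- cover solvable.
ProbSolvableAtMost : (k n t : ℕ) → Set
ProbSolvableAtMost k n t =
  Σ (List (Vec ℕ n)) λ L →
    Unique L ×
    LAll.All (λ c → sum c ≡ t × ¬ CoverSolvable c) L ×
    k * total n t ≤ suc k * length L

-- NonNegSurd a b c  means  a + b·√c ≥ 0  (a b : ℤ, c : ℕ), exactly.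
NonNegSurd : ℤ → ℤ → ℕ → Set
NonNegSurd a b c =
  (0ℤ ℤ.≤ a × 0ℤ ℤ.≤ b)
  ⊎ (0ℤ ℤ.≤ a × b ℤ.< 0ℤ × b ℤ.* b ℤ.* + c ℤ.≤ a ℤ.* a)
  ⊎ (a ℤ.< 0ℤ × 0ℤ ℤ.≤ b × a ℤ.* a ℤ.≤ b ℤ.* b ℤ.* + c)

-- GoldenAbove M n t  means  t ≥ γ n + M √n,  γ = (1+√5)/2.
-- Equivalently u ≥ √5·n with u = (2t − n) − 2M√n, i.e. u ≥ 0 and u² ≥ 5n².
GoldenAbove : ℕ → ℕ → ℕ → Set
GoldenAbove M n t =
  NonNegSurd A (- (+ 2 ℤ.* m)) n ×
  NonNegSurd (A ℤ.* A ℤ.+ + 4 ℤ.* m ℤ.* m ℤ.* + n ℤ.- + 5 ℤ.* + n ℤ.* + n)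
             (- (+ 4 ℤ.* m ℤ.* A)) n
  where
  A = + (2 * t) ℤ.- + n
  m = + M

-- GoldenBelow M n t  means  t ≤ γ n − M √n.
-- Equivalently v ≤ √5·n with v = (2t − n) + 2M√n, i.e. v ≤ 0 or v² ≤ 5n².
GoldenBelow : ℕ → ℕ → ℕ → Set
GoldenBelow M n t =
  NonNegSurd (- A) (- (+ 2 ℤ.* m)) n
  ⊎ NonNegSurd (+ 5 ℤ.* + n ℤ.* + n ℤ.- A ℤ.* A ℤ.- + 4 ℤ.* m ℤ.* m ℤ.* + n)
               (- (+ 4 ℤ.* m ℤ.* A)) n
  where
  A = + (2 * t) ℤ.- + n
  m = + M

module Submission where

-- On K_n a configuration c is cover solvable iff n + evens c ≤ sum c, where evens c counts the
-- vertices holding an even number (possibly zero) of pebbles. Writing t = n + a with a = 2q + r, a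
-- configuration with r + 2i even vertices is a choice of those vertices and of halves ⌊c_v/2⌋ summing
-- to q + r + i, so there are C(n, r+2i) · C(n−1+q+r+i, n−1) of them, and the solvable ones are the
-- classes i ≤ q.
-- The ratio of consecutive class sizes is (n−w)(n−w−1)(m+n) / ((w+1)(w+2)(m+1)) for w = r + 2i and
-- m = q + r + i; near i = q its comparison with 1 is the sign of t² − t n − n², i.e. of t − γ n.
-- If t ≥ γ n + M √n (M = 48 (k+1)) the classes from q − D on shrink by the factor n / (n + D) per
-- step, so with D² ≈ (k+1) n a shift by D classes costs (1 + D/n)^D ≥ k + 1 and the unsolvable
-- classes form at most a 1/(k+1) share; if t ≤ γ n − M √n the classes grow up to q + D and the
-- solvable ones form at most that share.

open import Defs
open import Data.Nat using (ℕ; _≤_)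
open import Data.Product using (_×_; ∃)

open import Data.Nat
open import Data.Nat.Properties
open import Data.Nat.Solver using (module +-*-Solver)
open +-*-Solver using (solve; _:+_; _:*_; con; _:=_)
open import Data.Nat.Combinatorics using (_C_; nCn≡1; nC1≡n; nCk+nC[k+1]≡[n+1]C[k+1])
import Algebra.Properties.CommutativeSemigroup as CommutativeSemigroupProperties
open import Data.Fin using (Fin; zero; suc)
open import Data.Fin.Subset using (Subset; Side; ∣_∣; inside; outside)
open import Data.Fin.Subset.Properties using (∣p∣≤n)
open import Data.Vec as Vec using (Vec; []; _∷_; lookup; sum; _[_]%=_)
open import Data.Vec.Properties using (lookup∘updateAt′; map-id; ∷-injectiveʳ)
open import Data.Vec.Relation.Unary.All using (All; []; _∷_)
open import Data.List as List using (List; []; _∷_; [_]; _++_; length; cartesianProductWith)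
open import Data.List.Properties using (length-++; length-map; length-removeAt′)
open import Data.List.Membership.Propositional using (_∈_)
open import Data.List.Membership.Propositional.Properties
  using (∈-map⁺; ∈-map⁻; ∈-++⁺ˡ; ∈-++⁺ʳ; ∈-++⁻; ∈-cartesianProductWith⁺; ∈-cartesianProductWith⁻)
open import Data.List.Relation.Binary.Subset.Propositional using (_⊆_)
open import Data.List.Relation.Unary.Any using (here; there; _─_; index)
open import Data.List.Relation.Unary.All as LAll using ([]; _∷_)
open import Data.List.Relation.Unary.Unique.Propositional using (Unique; []; _∷_)
import Data.List.Relation.Unary.Unique.Propositional.Properties as Unique
open import Data.Product using (∃₂; _,_; proj₁; proj₂)
open import Data.Sum using (_⊎_; inj₁; inj₂)
open import Data.Empty using (⊥; ⊥-elim)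
open import Function using (_∘_; id)
open import Function.Bundles using (_⇔_; mk⇔; Equivalence)
open import Relation.Nullary using (¬_; yes; no; contradiction)
open import Relation.Binary.PropositionalEquality hiding ([_])
open import Relation.Binary.Construct.Closure.ReflexiveTransitive using (ε; _◅_)

module +-CS = CommutativeSemigroupProperties +-commutativeSemigroup
module *-CS = CommutativeSemigroupProperties *-commutativeSemigroup

-- Cover solvability on K_n

evenBit : ℕ → ℕ
evenBit zero = 1
evenBit (suc zero) = 0
evenBit (suc (suc x)) = evenBit x

emptyBit : ℕ → ℕ
emptyBit zero = 1
emptyBit (suc _) = 0

tally : ∀ {n} → (ℕ → ℕ) → Vec ℕ n → ℕ
tally f v = sum (Vec.map f v)

evens : ∀ {n} → Vec ℕ n → ℕ
evens = tally evenBit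

empties : ∀ {n} → Vec ℕ n → ℕ
empties = tally emptyBit

evenBit≤1 : ∀ x → evenBit x ≤ 1
evenBit≤1 zero = s≤s z≤n
evenBit≤1 (suc zero) = z≤n
evenBit≤1 (suc (suc x)) = evenBit≤1 x

evenBit-∸2 : ∀ {x} → 2 ≤ x → evenBit (x ∸ 2) ≡ evenBit x
evenBit-∸2 (s≤s (s≤s _)) = refl

emptyBit-∸2 : ∀ {x} → 3 ≤ x → emptyBit (x ∸ 2) ≡ emptyBit x
emptyBit-∸2 (s≤s (s≤s (s≤s _))) = refl

tally-updateAt : ∀ {n} (f : ℕ → ℕ) (v : Vec ℕ n) i g →
  tally f (v [ i ]%= g) + f (lookup v i) ≡ tally f v + f (g (lookup v i))
tally-updateAt f (x ∷ v) zero g =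
  +-CS.xy∙z≈zy∙x (f (g x)) (tally f v) (f x)
tally-updateAt f (x ∷ v) (suc i) g = begin
  f x + tally f (v [ i ]%= g) + f (lookup v i)   ≡⟨ +-assoc (f x) _ _ ⟩
  f x + (tally f (v [ i ]%= g) + f (lookup v i)) ≡⟨ cong (f x +_) (tally-updateAt f v i g) ⟩
  f x + (tally f v + f (g (lookup v i)))         ≡⟨ +-assoc (f x) _ _ ⟨
  f x + tally f v + f (g (lookup v i))           ∎
  where open ≡-Reasoning

pebbleMove : ∀ {n} → Vec ℕ n → Fin n → Fin n → Vec ℕ n
pebbleMove c i j = (c [ i ]%= (_∸ 2)) [ j ]%= suc

tally-pebbleMove : ∀ {n} f (c : Vec ℕ n) {i j} → i ≢ j →
  tally f (pebbleMove c i j) + f (lookup c j) + f (lookup c i)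
    ≡ tally f c + f (suc (lookup c j)) + f (lookup c i ∸ 2)
tally-pebbleMove f c {i} {j} i≢j = begin
  tally f c′ + f y + f x                ≡⟨ cong (λ z → tally f c′ + f z + f x) c₁j≡y ⟨
  tally f c′ + f (lookup c₁ j) + f x    ≡⟨ cong (_+ f x) (tally-updateAt f c₁ j suc) ⟩
  tally f c₁ + f (suc (lookup c₁ j)) + f x ≡⟨ cong (λ z → tally f c₁ + f (suc z) + f x) c₁j≡y ⟩
  tally f c₁ + f (suc y) + f x          ≡⟨ +-CS.xy∙z≈xz∙y (tally f c₁) (f (suc y)) (f x) ⟩
  tally f c₁ + f x + f (suc y)          ≡⟨ cong (_+ f (suc y)) (tally-updateAt f c i (_∸ 2)) ⟩
  tally f c + f (x ∸ 2) + f (suc y)     ≡⟨ +-CS.xy∙z≈xz∙y (tally f c) (f (x ∸ 2)) (f (suc y)) ⟩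
  tally f c + f (suc y) + f (x ∸ 2)     ∎
  where
  open ≡-Reasoning
  x = lookup c i
  y = lookup c j
  c₁ = c [ i ]%= (_∸ 2)
  c′ = pebbleMove c i j
  c₁j≡y : lookup c₁ j ≡ y
  c₁j≡y = lookup∘updateAt′ j i (i≢j ∘ sym) c

sum≡tally-id : ∀ {n} (v : Vec ℕ n) → sum v ≡ tally id v
sum≡tally-id v = cong sum (sym (map-id v))

tally-pebbleMove-stable : ∀ {n} f (c : Vec ℕ n) {i j} → i ≢ j → f (lookup c i ∸ 2) ≡ f (lookup c i) →
  tally f (pebbleMove c i j) + f (lookup c j) ≡ tally f c + f (suc (lookup c j))
tally-pebbleMove-stable f c {i} {j} i≢j stable =
  +-cancelʳ-≡ (f (lookup c i)) _ _ (trans (tally-pebbleMove f c i≢j) (cong (tally f c + f (suc (lookup c j)) +_) stable))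

pebbleMove-sum : ∀ {n} (c : Vec ℕ n) {i j} → i ≢ j → 2 ≤ lookup c i → sum c ≡ suc (sum (pebbleMove c i j))
pebbleMove-sum c {i} {j} i≢j 2≤x = begin
  sum c                                  ≡⟨ sum≡tally-id c ⟩
  tally id c                             ≡⟨ spend 2≤x (tally-pebbleMove id c i≢j) ⟩
  suc (tally id (pebbleMove c i j))      ≡⟨ cong suc (sum≡tally-id (pebbleMove c i j)) ⟨
  suc (sum (pebbleMove c i j))           ∎
  where
  open ≡-Reasoning
  spend : ∀ {T T′ x y} → 2 ≤ x → T′ + y + x ≡ T + suc y + (x ∸ 2) → T ≡ suc T′
  spend {T} {T′} {suc (suc x)} {y} _ e = +-cancelʳ-≡ (suc y + x) _ _ (begin
    T + (suc y + x)         ≡⟨ +-assoc T (suc y) x ⟨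
    T + suc y + x           ≡⟨ e ⟨
    T′ + y + suc (suc x)    ≡⟨ solve 3 (λ T′ y x → T′ :+ y :+ (con 2 :+ x) := (con 1 :+ T′) :+ (con 1 :+ y :+ x)) refl T′ y x ⟩
    suc T′ + (suc y + x)    ∎)
  spend {x = suc zero} (s≤s ()) _

pebbleMove-evens : ∀ {n} (c : Vec ℕ n) {i j} → i ≢ j → 2 ≤ lookup c i →
  evens (pebbleMove c i j) + evenBit (lookup c j) ≡ evens c + evenBit (suc (lookup c j))
pebbleMove-evens c i≢j 2≤x = tally-pebbleMove-stable evenBit c i≢j (evenBit-∸2 2≤x)

move-sum : ∀ {n} {c c′ : Vec ℕ n} → Move c c′ → sum c ≡ suc (sum c′)
move-sum (move c i j i≢j 2≤x) = pebbleMove-sum c i≢j 2≤x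

move-evens : ∀ {n} {c c′ : Vec ℕ n} → Move c c′ → evens c ≤ suc (evens c′)
move-evens (move c i j i≢j 2≤x) = begin
  evens c                              ≤⟨ m≤m+n (evens c) _ ⟩
  evens c + evenBit (suc y)            ≡⟨ pebbleMove-evens c i≢j 2≤x ⟨
  evens (pebbleMove c i j) + evenBit y ≤⟨ +-monoʳ-≤ _ (evenBit≤1 y) ⟩
  evens (pebbleMove c i j) + 1         ≡⟨ +-comm _ 1 ⟩
  suc (evens (pebbleMove c i j))       ∎
  where
  open ≤-Reasoning
  y = lookup c j

-- Each move spends one pebble and destroys at most one even vertex, so sum − evens never increases.
reachable-sum+evens : ∀ {n} {c D : Vec ℕ n} → Reachable c D → sum D + evens c ≤ sum c + evens D
reachable-sum+evens ε = ≤-refl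
reachable-sum+evens {c = c} {D} (_◅_ {j = c′} m r) = begin
  sum D + evens c          ≤⟨ +-monoʳ-≤ (sum D) (move-evens m) ⟩
  sum D + suc (evens c′)   ≡⟨ +-suc (sum D) (evens c′) ⟩
  suc (sum D + evens c′)   ≤⟨ s≤s (reachable-sum+evens r) ⟩
  suc (sum c′ + evens D)   ≡⟨ cong (_+ evens D) (move-sum m) ⟨
  sum c + evens D          ∎
  where open ≤-Reasoning

covered-bound : ∀ {n} {D : Vec ℕ n} → All (1 ≤_) D → n + evens D ≤ sum D
covered-bound [] = z≤n
covered-bound {suc n} {x ∷ D} (1≤x ∷ 1≤D) = begin
  suc n + (evenBit x + evens D)   ≡⟨ solve 3 (λ n e E → con 1 :+ n :+ (e :+ E) := (con 1 :+ e) :+ (n :+ E)) refl n (evenBit x) (evens D) ⟩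
  suc (evenBit x) + (n + evens D) ≤⟨ +-mono-≤ (entry 1≤x) (covered-bound 1≤D) ⟩
  x + sum D                       ∎
  where
  open ≤-Reasoning
  entry : ∀ {x} → 1 ≤ x → suc (evenBit x) ≤ x
  entry {suc zero} _ = s≤s z≤n
  entry {suc (suc x)} _ = s≤s (≤-trans (evenBit≤1 x) (s≤s z≤n))

coverSolvable⇒ : ∀ {n} (c : Vec ℕ n) → CoverSolvable c → n + evens c ≤ sum c
coverSolvable⇒ {n} c (D , c↝D , covered) = +-cancelʳ-≤ (evens D) _ _ (begin
  n + evens c + evens D   ≡⟨ +-CS.xy∙z≈xz∙y n (evens c) (evens D) ⟩
  n + evens D + evens c   ≤⟨ +-monoˡ-≤ (evens c) (covered-bound covered) ⟩
  sum D + evens c         ≤⟨ reachable-sum+evens c↝D ⟩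
  sum c + evens D         ∎)
  where open ≤-Reasoning

someOrAll : ∀ {P Q : ℕ → Set} → (∀ x → P x ⊎ Q x) →
            ∀ {n} (v : Vec ℕ n) → (∃ λ i → P (lookup v i)) ⊎ All Q v
someOrAll split [] = inj₂ []
someOrAll split (x ∷ v) with split x | someOrAll split v
... | inj₁ px | _ = inj₁ (zero , px)
... | inj₂ _ | inj₁ (i , p) = inj₁ (suc i , p)
... | inj₂ qx | inj₂ qv = inj₂ (qx ∷ qv)

empty-or-occupied : ∀ x → x ≡ 0 ⊎ 1 ≤ x
empty-or-occupied zero = inj₁ refl
empty-or-occupied (suc x) = inj₂ (s≤s z≤n)

empty⇒1≤empties : ∀ {n} (v : Vec ℕ n) {j} → lookup v j ≡ 0 → 1 ≤ empties v
empty⇒1≤empties (x ∷ v) {zero} refl = s≤s z≤n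
empty⇒1≤empties (x ∷ v) {suc j} vj≡0 = ≤-trans (empty⇒1≤empties v vj≡0) (m≤n+m _ (emptyBit x))

sum+2*empties≡n+evens : ∀ {n} {v : Vec ℕ n} → All (_≤ 2) v → sum v + 2 * empties v ≡ n + evens v
sum+2*empties≡n+evens [] = refl
sum+2*empties≡n+evens {suc n} {x ∷ v} (x≤2 ∷ v≤2) = begin
  x + sum v + 2 * (emptyBit x + empties v)
    ≡⟨ solve 4 (λ x s z Z → x :+ s :+ con 2 :* (z :+ Z) := (x :+ con 2 :* z) :+ (s :+ con 2 :* Z)) refl x (sum v) (emptyBit x) (empties v) ⟩
  (x + 2 * emptyBit x) + (sum v + 2 * empties v)
    ≡⟨ cong₂ _+_ (entry x≤2) (sum+2*empties≡n+evens v≤2) ⟩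
  suc (evenBit x) + (n + evens v)
    ≡⟨ solve 3 (λ e n E → (con 1 :+ e) :+ (n :+ E) := con 1 :+ n :+ (e :+ E)) refl (evenBit x) n (evens v) ⟩
  suc n + (evenBit x + evens v) ∎
  where
  open ≡-Reasoning
  entry : ∀ {x} → x ≤ 2 → x + 2 * emptyBit x ≡ suc (evenBit x)
  entry {0} _ = refl
  entry {1} _ = refl
  entry {2} _ = refl
  entry {suc (suc (suc _))} (s≤s (s≤s ()))

-- Some vertex i has at least three pebbles (otherwise sum c + 2 · empties c = n + evens c ≤ sum c);
-- moving two of them onto j spends one pebble and turns the even vertex j odd.
fill-empty : ∀ {n} (c : Vec ℕ n) {j} → lookup c j ≡ 0 → n + evens c ≤ sum c →
  ∃ λ c′ → Move c c′ × n + evens c′ ≤ sum c′ × empties c ≡ suc (empties c′)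
fill-empty {n} c {j} cj≡0 enough with someOrAll (<-≤-connex 2) c
... | inj₂ small = ⊥-elim (m+1+n≰m (sum c) (begin
  sum c + suc _       ≤⟨ +-monoʳ-≤ (sum c) (*-monoʳ-≤ 2 (empty⇒1≤empties c cj≡0)) ⟩
  sum c + 2 * empties c ≡⟨ sum+2*empties≡n+evens small ⟩
  n + evens c         ≤⟨ enough ⟩
  sum c               ∎))
  where open ≤-Reasoning
... | inj₁ (i , 3≤x) = c′ , move c i j i≢j 2≤x , enough′ , empties-drop
  where
  c′ = pebbleMove c i j
  2≤x : 2 ≤ lookup c i
  2≤x = ≤-trans (n≤1+n 2) 3≤x
  i≢j : i ≢ j
  i≢j refl = contradiction (subst (3 ≤_) cj≡0 3≤x) λ ()
  drop-one : ∀ {a b} → a + 1 ≡ b + 0 → b ≡ suc a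
  drop-one {a} {b} e = trans (sym (+-identityʳ b)) (trans (sym e) (+-comm a 1))
  at-j : ∀ (f : ℕ → ℕ) → tally f c′ + f (lookup c j) ≡ tally f c + f (suc (lookup c j)) →
         tally f c′ + f 0 ≡ tally f c + f 1
  at-j f = subst (λ y → tally f c′ + f y ≡ tally f c + f (suc y)) cj≡0
  evens-drop : evens c ≡ suc (evens c′)
  evens-drop = drop-one (at-j evenBit (pebbleMove-evens c i≢j 2≤x))
  empties-drop : empties c ≡ suc (empties c′)
  empties-drop = drop-one (at-j emptyBit (tally-pebbleMove-stable emptyBit c i≢j (emptyBit-∸2 3≤x)))
  enough′ : n + evens c′ ≤ sum c′
  enough′ = ≤-pred (begin
    suc (n + evens c′) ≡⟨ +-suc n (evens c′) ⟨
    n + suc (evens c′) ≡⟨ cong (n +_) evens-drop ⟨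
    n + evens c        ≤⟨ enough ⟩
    sum c              ≡⟨ pebbleMove-sum c i≢j 2≤x ⟩
    suc (sum c′)       ∎)
    where open ≤-Reasoning

coverSolvable⇐ : ∀ {n} (c : Vec ℕ n) → n + evens c ≤ sum c → CoverSolvable c
coverSolvable⇐ {n} c = fill (empties c) c refl
  where
  fill : ∀ z (c : Vec ℕ n) → empties c ≡ z → n + evens c ≤ sum c → CoverSolvable c
  fill z c eq enough with someOrAll empty-or-occupied c
  ... | inj₂ covered = c , ε , covered
  ... | inj₁ (j , cj≡0) with fill-empty c cj≡0 enough | z
  ...   | c′ , m , enough′ , drop | zero = contradiction (trans (sym drop) eq) λ ()
  ...   | c′ , m , enough′ , drop | suc z′ with fill z′ c′ (suc-injective (trans (sym drop) eq)) enough′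
  ...     | D , c′↝D , covered = D , m ◅ c′↝D , covered

coverSolvable⇔ : ∀ {n} (c : Vec ℕ n) → CoverSolvable c ⇔ n + evens c ≤ sum c
coverSolvable⇔ c = mk⇔ (coverSolvable⇒ c) (coverSolvable⇐ c)

-- Enumerating configurations

length-map++map : ∀ {A B C : Set} (f : A → C) (g : B → C) xs ys →
                  length (List.map f xs ++ List.map g ys) ≡ length xs + length ys
length-map++map f g xs ys = trans (length-++ (List.map f xs)) (cong₂ _+_ (length-map f xs) (length-map g ys))

incrementHead : ∀ {n} → Vec ℕ (suc n) → Vec ℕ (suc n)
incrementHead (x ∷ v) = suc x ∷ v

compositions : (n m : ℕ) → List (Vec ℕ n)
compositions zero zero = [ [] ]
compositions zero (suc m) = []
compositions (suc n) zero = List.map (0 ∷_) (compositions n zero)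
compositions (suc n) (suc m) =
  List.map (0 ∷_) (compositions n (suc m)) ++ List.map incrementHead (compositions (suc n) m)

∈-compositions⁻ : ∀ n m {v} → v ∈ compositions n m → sum v ≡ m
∈-compositions⁻ zero zero {[]} _ = refl
∈-compositions⁻ (suc n) zero v∈ with ∈-map⁻ (0 ∷_) v∈
... | _ , u∈ , refl = ∈-compositions⁻ n zero u∈
∈-compositions⁻ (suc n) (suc m) v∈ with ∈-++⁻ (List.map (0 ∷_) (compositions n (suc m))) v∈
... | inj₁ v∈₁ with ∈-map⁻ (0 ∷_) v∈₁
...   | _ , u∈ , refl = ∈-compositions⁻ n (suc m) u∈
∈-compositions⁻ (suc n) (suc m) v∈ | inj₂ v∈₂ with ∈-map⁻ incrementHead v∈₂
...   | _ ∷ _ , u∈ , refl = cong suc (∈-compositions⁻ (suc n) m u∈)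

∈-compositions⁺ : ∀ {n m} (v : Vec ℕ n) → sum v ≡ m → v ∈ compositions n m
∈-compositions⁺ {zero} {zero} [] _ = here refl
∈-compositions⁺ {suc n} {zero} (zero ∷ v) s = ∈-map⁺ (0 ∷_) (∈-compositions⁺ v s)
∈-compositions⁺ {suc n} {suc m} (zero ∷ v) s = ∈-++⁺ˡ (∈-map⁺ (0 ∷_) (∈-compositions⁺ v s))
∈-compositions⁺ {suc n} {suc m} (suc x ∷ v) s =
  ∈-++⁺ʳ _ (∈-map⁺ incrementHead (∈-compositions⁺ (x ∷ v) (suc-injective s)))

compositions-unique : ∀ n m → Unique (compositions n m)
compositions-unique zero zero = [] ∷ []
compositions-unique zero (suc m) = []
compositions-unique (suc n) zero = Unique.map⁺ ∷-injectiveʳ (compositions-unique n zero)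
compositions-unique (suc n) (suc m) =
  Unique.++⁺ (Unique.map⁺ ∷-injectiveʳ (compositions-unique n (suc m)))
             (Unique.map⁺ incrementHead-injective (compositions-unique (suc n) m))
             disjoint
  where
  incrementHead-injective : ∀ {u v : Vec ℕ (suc n)} → incrementHead u ≡ incrementHead v → u ≡ v
  incrementHead-injective {_ ∷ _} {_ ∷ _} refl = refl
  disjoint : ∀ {v} → v ∈ List.map (0 ∷_) (compositions n (suc m)) × v ∈ List.map incrementHead (compositions (suc n) m) → ⊥
  disjoint (v∈₁ , v∈₂) with ∈-map⁻ (0 ∷_) v∈₁ | ∈-map⁻ incrementHead v∈₂
  ... | _ , _ , refl | _ ∷ _ , _ , ()

length-compositions : ∀ n m → length (compositions (suc n) m) ≡ (n + m) C n
length-compositions n zero = trans (single (suc n)) (sym (trans (cong (_C n) (+-identityʳ n)) (nCn≡1 n)))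
  where
  single : ∀ n → length (compositions n zero) ≡ 1
  single zero = refl
  single (suc n) = trans (length-map (0 ∷_) (compositions n zero)) (single n)
length-compositions zero (suc m) =
  trans (length-map incrementHead (compositions 1 m)) (length-compositions zero m)
length-compositions (suc n) (suc m) = begin
  length (List.map (0 ∷_) (compositions (suc n) (suc m)) ++ List.map incrementHead (compositions (suc (suc n)) m))
    ≡⟨ length-map++map (0 ∷_) incrementHead (compositions (suc n) (suc m)) _ ⟩
  length (compositions (suc n) (suc m)) + length (compositions (suc (suc n)) m)
    ≡⟨ cong₂ _+_ (length-compositions n (suc m)) (length-compositions (suc n) m) ⟩
  (n + suc m) C n + (suc n + m) C suc n
    ≡⟨ cong (λ z → (n + suc m) C n + z C suc n) (+-suc n m) ⟨
  (n + suc m) C n + (n + suc m) C suc n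
    ≡⟨ nCk+nC[k+1]≡[n+1]C[k+1] (n + suc m) n ⟩
  suc (n + suc m) C suc n ∎
  where open ≡-Reasoning

subsetsOfSize : (n w : ℕ) → List (Subset n)
subsetsOfSize zero zero = [ [] ]
subsetsOfSize zero (suc w) = []
subsetsOfSize (suc n) zero = List.map (outside ∷_) (subsetsOfSize n zero)
subsetsOfSize (suc n) (suc w) =
  List.map (inside ∷_) (subsetsOfSize n w) ++ List.map (outside ∷_) (subsetsOfSize n (suc w))

∈-subsetsOfSize⁻ : ∀ n w {S} → S ∈ subsetsOfSize n w → ∣ S ∣ ≡ w
∈-subsetsOfSize⁻ zero zero {[]} _ = refl
∈-subsetsOfSize⁻ (suc n) zero S∈ with ∈-map⁻ (outside ∷_) S∈
... | _ , T∈ , refl = ∈-subsetsOfSize⁻ n zero T∈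
∈-subsetsOfSize⁻ (suc n) (suc w) S∈ with ∈-++⁻ (List.map (inside ∷_) (subsetsOfSize n w)) S∈
... | inj₁ S∈₁ with ∈-map⁻ (inside ∷_) S∈₁
...   | _ , T∈ , refl = cong suc (∈-subsetsOfSize⁻ n w T∈)
∈-subsetsOfSize⁻ (suc n) (suc w) S∈ | inj₂ S∈₂ with ∈-map⁻ (outside ∷_) S∈₂
...   | _ , T∈ , refl = ∈-subsetsOfSize⁻ n (suc w) T∈

∈-subsetsOfSize⁺ : ∀ {n w} (S : Subset n) → ∣ S ∣ ≡ w → S ∈ subsetsOfSize n w
∈-subsetsOfSize⁺ {zero} {zero} [] _ = here refl
∈-subsetsOfSize⁺ {suc n} {zero} (outside ∷ S) s = ∈-map⁺ (outside ∷_) (∈-subsetsOfSize⁺ S s)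
∈-subsetsOfSize⁺ {suc n} {suc w} (inside ∷ S) s = ∈-++⁺ˡ (∈-map⁺ (inside ∷_) (∈-subsetsOfSize⁺ S (suc-injective s)))
∈-subsetsOfSize⁺ {suc n} {suc w} (outside ∷ S) s = ∈-++⁺ʳ _ (∈-map⁺ (outside ∷_) (∈-subsetsOfSize⁺ S s))

subsetsOfSize-unique : ∀ n w → Unique (subsetsOfSize n w)
subsetsOfSize-unique zero zero = [] ∷ []
subsetsOfSize-unique zero (suc w) = []
subsetsOfSize-unique (suc n) zero = Unique.map⁺ ∷-injectiveʳ (subsetsOfSize-unique n zero)
subsetsOfSize-unique (suc n) (suc w) =
  Unique.++⁺ (Unique.map⁺ ∷-injectiveʳ (subsetsOfSize-unique n w))
             (Unique.map⁺ ∷-injectiveʳ (subsetsOfSize-unique n (suc w)))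
             disjoint
  where
  disjoint : ∀ {S} → S ∈ List.map (inside ∷_) (subsetsOfSize n w) × S ∈ List.map (outside ∷_) (subsetsOfSize n (suc w)) → ⊥
  disjoint (S∈₁ , S∈₂) with ∈-map⁻ (inside ∷_) S∈₁ | ∈-map⁻ (outside ∷_) S∈₂
  ... | _ , _ , refl | _ , _ , ()

length-subsetsOfSize : ∀ n w → length (subsetsOfSize n w) ≡ n C w
length-subsetsOfSize zero zero = refl
length-subsetsOfSize zero (suc w) = refl
length-subsetsOfSize (suc n) zero =
  trans (length-map (outside ∷_) (subsetsOfSize n zero)) (length-subsetsOfSize n zero)
length-subsetsOfSize (suc n) (suc w) = begin
  length (List.map (inside ∷_) (subsetsOfSize n w) ++ List.map (outside ∷_) (subsetsOfSize n (suc w)))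
    ≡⟨ length-map++map (inside ∷_) (outside ∷_) (subsetsOfSize n w) _ ⟩
  length (subsetsOfSize n w) + length (subsetsOfSize n (suc w))
    ≡⟨ cong₂ _+_ (length-subsetsOfSize n w) (length-subsetsOfSize n (suc w)) ⟩
  n C w + n C suc w
    ≡⟨ nCk+nC[k+1]≡[n+1]C[k+1] n w ⟩
  suc n C suc w ∎
  where open ≡-Reasoning

fromParityHalf : Side → ℕ → ℕ
fromParityHalf inside h = 2 * h
fromParityHalf outside h = suc (2 * h)

assemble : ∀ {n} → Subset n → Vec ℕ n → Vec ℕ n
assemble = Vec.zipWith fromParityHalf

fromParityHalf-suc : ∀ p h → fromParityHalf p (suc h) ≡ 2 + fromParityHalf p h
fromParityHalf-suc inside h = *-suc 2 h
fromParityHalf-suc outside h = cong suc (*-suc 2 h)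

fromParityHalf-surjective : ∀ x → ∃₂ λ p h → fromParityHalf p h ≡ x
fromParityHalf-surjective zero = inside , 0 , refl
fromParityHalf-surjective (suc zero) = outside , 0 , refl
fromParityHalf-surjective (suc (suc x)) with fromParityHalf-surjective x
... | p , h , refl = p , suc h , fromParityHalf-suc p h

fromParityHalf-injective : ∀ {p q g h} → fromParityHalf p g ≡ fromParityHalf q h → p ≡ q × g ≡ h
fromParityHalf-injective {inside} {inside} e = refl , *-cancelˡ-≡ _ _ 2 e
fromParityHalf-injective {outside} {outside} e = refl , *-cancelˡ-≡ _ _ 2 (suc-injective e)
fromParityHalf-injective {inside} {outside} {g} {h} e = ⊥-elim (even≢odd g h e)
fromParityHalf-injective {outside} {inside} {g} {h} e = ⊥-elim (even≢odd h g (sym e))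

evenBit-fromParityHalf : ∀ p h → evenBit (fromParityHalf p h) ≡ ∣ p ∷ [] ∣
evenBit-fromParityHalf p zero with p
... | inside = refl
... | outside = refl
evenBit-fromParityHalf p (suc h) = trans (cong evenBit (fromParityHalf-suc p h)) (evenBit-fromParityHalf p h)

∣p∷S∣≡∣p∷[]∣+∣S∣ : ∀ {n} p (S : Subset n) → ∣ p ∷ S ∣ ≡ ∣ p ∷ [] ∣ + ∣ S ∣
∣p∷S∣≡∣p∷[]∣+∣S∣ inside S = refl
∣p∷S∣≡∣p∷[]∣+∣S∣ outside S = refl

evens-assemble : ∀ {n} (S : Subset n) h → evens (assemble S h) ≡ ∣ S ∣
evens-assemble [] [] = refl
evens-assemble (p ∷ S) (x ∷ h) =
  trans (cong₂ _+_ (evenBit-fromParityHalf p x) (evens-assemble S h)) (sym (∣p∷S∣≡∣p∷[]∣+∣S∣ p S))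

sum-assemble : ∀ {n} (S : Subset n) h → sum (assemble S h) + ∣ S ∣ ≡ 2 * sum h + n
sum-assemble [] [] = refl
sum-assemble {suc n} (p ∷ S) (x ∷ h) = begin
  fromParityHalf p x + sum (assemble S h) + ∣ p ∷ S ∣
    ≡⟨ cong (fromParityHalf p x + sum (assemble S h) +_) (∣p∷S∣≡∣p∷[]∣+∣S∣ p S) ⟩
  fromParityHalf p x + sum (assemble S h) + (∣ p ∷ [] ∣ + ∣ S ∣)
    ≡⟨ +-CS.interchange (fromParityHalf p x) (sum (assemble S h)) ∣ p ∷ [] ∣ ∣ S ∣ ⟩
  fromParityHalf p x + ∣ p ∷ [] ∣ + (sum (assemble S h) + ∣ S ∣)
    ≡⟨ cong₂ _+_ (entry p) (sum-assemble S h) ⟩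
  suc (2 * x) + (2 * sum h + n)
    ≡⟨ solve 3 (λ x s n → con 1 :+ con 2 :* x :+ (con 2 :* s :+ n) := con 2 :* (x :+ s) :+ (con 1 :+ n)) refl x (sum h) n ⟩
  2 * (x + sum h) + suc n ∎
  where
  open ≡-Reasoning
  entry : ∀ p → fromParityHalf p x + ∣ p ∷ [] ∣ ≡ suc (2 * x)
  entry inside = +-comm (2 * x) 1
  entry outside = +-identityʳ (suc (2 * x))

assemble-injective : ∀ {n} {S T : Subset n} {g h} → assemble S g ≡ assemble T h → S ≡ T × g ≡ h
assemble-injective {S = []} {[]} {[]} {[]} _ = refl , refl
assemble-injective {S = p ∷ S} {q ∷ T} {x ∷ g} {y ∷ h} e
  with fromParityHalf-injective {p} {q} {x} {y} (cong Vec.head e) | assemble-injective {S = S} {T} {g} {h} (cong Vec.tail e)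
... | refl , refl | refl , refl = refl , refl

assemble-surjective : ∀ {n} (v : Vec ℕ n) → ∃₂ λ S h → assemble S h ≡ v
assemble-surjective [] = [] , [] , refl
assemble-surjective (x ∷ v) with fromParityHalf-surjective x | assemble-surjective v
... | p , y , refl | S , h , refl = p ∷ S , y ∷ h , refl

∈-─⁺ : ∀ {A : Set} {x y : A} {ys} (x∈ys : x ∈ ys) → y ∈ ys → y ≢ x → y ∈ (ys ─ x∈ys)
∈-─⁺ (here refl) (here refl) y≢x = ⊥-elim (y≢x refl)
∈-─⁺ (here _) (there y∈ys) _ = y∈ys
∈-─⁺ (there _) (here y≡z) _ = here y≡z
∈-─⁺ (there x∈ys) (there y∈ys) y≢x = there (∈-─⁺ x∈ys y∈ys y≢x)

unique-⊆⇒length≤ : ∀ {A : Set} {xs ys : List A} → Unique xs → xs ⊆ ys → length xs ≤ length ys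
unique-⊆⇒length≤ {xs = []} _ _ = z≤n
unique-⊆⇒length≤ {xs = x ∷ xs} {ys} (x∉xs ∷ xs!) xs⊆ys = begin
  suc (length xs)                   ≤⟨ s≤s (unique-⊆⇒length≤ xs! xs⊆ys─x) ⟩
  suc (length (ys ─ x∈ys))          ≡⟨ length-removeAt′ ys (index x∈ys) ⟨
  length ys                         ∎
  where
  open ≤-Reasoning
  x∈ys = xs⊆ys (here refl)
  xs⊆ys─x : xs ⊆ (ys ─ x∈ys)
  xs⊆ys─x y∈xs = ∈-─⁺ x∈ys (xs⊆ys (there y∈xs)) λ y≡x → LAll.lookup x∉xs y∈xs (sym y≡x)

length-cartesianProductWith : ∀ {A B C : Set} (f : A → B → C) xs ys →
  length (cartesianProductWith f xs ys) ≡ length xs * length ys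
length-cartesianProductWith f [] ys = refl
length-cartesianProductWith f (x ∷ xs) ys = begin
  length (List.map (f x) ys ++ cartesianProductWith f xs ys)       ≡⟨ length-++ (List.map (f x) ys) ⟩
  length (List.map (f x) ys) + length (cartesianProductWith f xs ys) ≡⟨ cong₂ _+_ (length-map (f x) ys) (length-cartesianProductWith f xs ys) ⟩
  length ys + length xs * length ys                                ∎
  where open ≡-Reasoning

-- Sums over ranges

rangeSum : (ℕ → ℕ) → ℕ → ℕ → ℕ
rangeSum g lo zero = 0
rangeSum g lo (suc len) = g lo + rangeSum g (suc lo) len

concatRange : ∀ {A : Set} → (ℕ → List A) → ℕ → ℕ → List A
concatRange f lo zero = []
concatRange f lo (suc len) = f lo ++ concatRange f (suc lo) len

rangeSum-cong : ∀ {g h} → (∀ i → g i ≡ h i) → ∀ lo len → rangeSum g lo len ≡ rangeSum h lo len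
rangeSum-cong g≗h lo zero = refl
rangeSum-cong g≗h lo (suc len) = cong₂ _+_ (g≗h lo) (rangeSum-cong g≗h (suc lo) len)

rangeSum-mono-≤ : ∀ {g h} lo len → (∀ i → lo ≤ i → i < lo + len → g i ≤ h i) →
                  rangeSum g lo len ≤ rangeSum h lo len
rangeSum-mono-≤ lo zero _ = z≤n
rangeSum-mono-≤ lo (suc len) g≤h = +-mono-≤ (g≤h lo ≤-refl (m<m+n lo z<s))
  (rangeSum-mono-≤ (suc lo) len λ i lo<i i<end → g≤h i (<⇒≤ lo<i) (subst (i <_) (sym (+-suc lo len)) i<end))

*-distribˡ-rangeSum : ∀ k g lo len → k * rangeSum g lo len ≡ rangeSum (λ i → k * g i) lo len
*-distribˡ-rangeSum k g lo zero = *-zeroʳ k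
*-distribˡ-rangeSum k g lo (suc len) =
  trans (*-distribˡ-+ k (g lo) _) (cong (k * g lo +_) (*-distribˡ-rangeSum k g (suc lo) len))

rangeSum-+ : ∀ g lo a b → rangeSum g lo (a + b) ≡ rangeSum g lo a + rangeSum g (lo + a) b
rangeSum-+ g lo zero b = cong (λ z → rangeSum g z b) (sym (+-identityʳ lo))
rangeSum-+ g lo (suc a) b = begin
  g lo + rangeSum g (suc lo) (a + b)                           ≡⟨ cong (g lo +_) (rangeSum-+ g (suc lo) a b) ⟩
  g lo + (rangeSum g (suc lo) a + rangeSum g (suc lo + a) b)   ≡⟨ +-assoc (g lo) _ _ ⟨
  g lo + rangeSum g (suc lo) a + rangeSum g (suc lo + a) b     ≡⟨ cong (λ z → g lo + rangeSum g (suc lo) a + rangeSum g z b) (+-suc lo a) ⟨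
  g lo + rangeSum g (suc lo) a + rangeSum g (lo + suc a) b     ∎
  where open ≡-Reasoning

rangeSum-shift : ∀ g lo d len → rangeSum g (lo + d) len ≡ rangeSum (λ i → g (i + d)) lo len
rangeSum-shift g lo d zero = refl
rangeSum-shift g lo d (suc len) = cong (g (lo + d) +_) (rangeSum-shift g (suc lo) d len)

rangeSum-⊆ : ∀ g lo len L → lo + len ≤ L → rangeSum g lo len ≤ rangeSum g 0 L
rangeSum-⊆ g lo len L lo+len≤L = begin
  rangeSum g lo len                                              ≤⟨ m≤n+m _ (rangeSum g 0 lo) ⟩
  rangeSum g 0 lo + rangeSum g lo len                            ≡⟨ rangeSum-+ g 0 lo len ⟨
  rangeSum g 0 (lo + len)                                        ≤⟨ m≤m+n _ _ ⟩
  rangeSum g 0 (lo + len) + rangeSum g (lo + len) (L ∸ (lo + len)) ≡⟨ rangeSum-+ g 0 (lo + len) _ ⟨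
  rangeSum g 0 (lo + len + (L ∸ (lo + len)))                     ≡⟨ cong (rangeSum g 0) (m+[n∸m]≡n lo+len≤L) ⟩
  rangeSum g 0 L                                                 ∎
  where open ≤-Reasoning

length-concatRange : ∀ {A : Set} (f : ℕ → List A) lo len →
                     length (concatRange f lo len) ≡ rangeSum (λ i → length (f i)) lo len
length-concatRange f lo zero = refl
length-concatRange f lo (suc len) =
  trans (length-++ (f lo)) (cong (length (f lo) +_) (length-concatRange f (suc lo) len))

∈-concatRange⁺ : ∀ {A : Set} (f : ℕ → List A) {lo len i x} → lo ≤ i → i < lo + len → x ∈ f i → x ∈ concatRange f lo len
∈-concatRange⁺ f {lo} {zero} lo≤i i<lo+0 _ = ⊥-elim (<⇒≱ i<lo+0 (subst (_≤ _) (sym (+-identityʳ lo)) lo≤i))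
∈-concatRange⁺ f {lo} {suc len} {i} lo≤i i<end x∈ with lo ≟ i
... | yes refl = ∈-++⁺ˡ x∈
... | no lo≢i = ∈-++⁺ʳ (f lo) (∈-concatRange⁺ f (≤∧≢⇒< lo≤i lo≢i) (subst (i <_) (+-suc lo len) i<end) x∈)

∈-concatRange⁻ : ∀ {A : Set} (f : ℕ → List A) lo len {x} → x ∈ concatRange f lo len →
                 ∃ λ i → lo ≤ i × i < lo + len × x ∈ f i
∈-concatRange⁻ f lo (suc len) x∈ with ∈-++⁻ (f lo) x∈
... | inj₁ x∈f = lo , ≤-refl , m<m+n lo z<s , x∈f
... | inj₂ x∈rest with ∈-concatRange⁻ f (suc lo) len x∈rest
...   | i , lo<i , i<end , x∈f = i , <⇒≤ lo<i , subst (i <_) (sym (+-suc lo len)) i<end , x∈f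

concatRange-unique : ∀ {A : Set} (f : ℕ → List A) (tag : A → ℕ) → (∀ i → Unique (f i)) →
                     (∀ i {x} → x ∈ f i → tag x ≡ i) → ∀ lo len → Unique (concatRange f lo len)
concatRange-unique f tag f! tagged lo zero = []
concatRange-unique f tag f! tagged lo (suc len) =
  Unique.++⁺ (f! lo) (concatRange-unique f tag f! tagged (suc lo) len) disjoint
  where
  disjoint : ∀ {x} → x ∈ f lo × x ∈ concatRange f (suc lo) len → ⊥
  disjoint (x∈f , x∈rest) with ∈-concatRange⁻ f (suc lo) len x∈rest
  ... | i , lo<i , _ , x∈fi = <⇒≢ lo<i (trans (sym (tagged lo x∈f)) (tagged i x∈fi))

rangeSum-tail-≤ : ∀ g k D q len → D ≤ suc q → (∀ j → suc q ∸ D ≤ j → suc k * g (j + D) ≤ g j) →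
                  k * rangeSum g (suc q) len ≤ rangeSum g 0 (suc q)
rangeSum-tail-≤ g k D q len D≤q+1 shift = +-cancelˡ-≤ B _ _ (begin
  B + k * B                                 ≡⟨ *-distribˡ-rangeSum (suc k) g (suc q) len ⟩
  rangeSum (λ i → suc k * g i) (suc q) len  ≡⟨ cong (λ z → rangeSum (λ i → suc k * g i) z len) (m∸n+n≡m D≤q+1) ⟨
  rangeSum (λ i → suc k * g i) (s + D) len  ≡⟨ rangeSum-shift (λ i → suc k * g i) s D len ⟩
  rangeSum (λ j → suc k * g (j + D)) s len  ≤⟨ rangeSum-mono-≤ s len (λ j s≤j _ → shift j s≤j) ⟩
  rangeSum g s len                          ≤⟨ rangeSum-⊆ g s len (suc q + len) (+-monoˡ-≤ len (m∸n≤m (suc q) D)) ⟩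
  rangeSum g 0 (suc q + len)                ≡⟨ rangeSum-+ g 0 (suc q) len ⟩
  rangeSum g 0 (suc q) + B                  ≡⟨ +-comm _ B ⟩
  B + rangeSum g 0 (suc q)                  ∎)
  where
  open ≤-Reasoning
  s = suc q ∸ D
  B = rangeSum g (suc q) len

rangeSum-head-≤ : ∀ g k D q len → D ≤ len → (∀ i → i ≤ q → suc k * g i ≤ g (i + D)) →
                  k * rangeSum g 0 (suc q) ≤ rangeSum g (suc q) len
rangeSum-head-≤ g k D q len D≤len shift = +-cancelˡ-≤ G _ _ (begin
  G + k * G                                 ≡⟨ *-distribˡ-rangeSum (suc k) g 0 (suc q) ⟩
  rangeSum (λ i → suc k * g i) 0 (suc q)    ≤⟨ rangeSum-mono-≤ 0 (suc q) (λ i _ i<q+1 → shift i (≤-pred i<q+1)) ⟩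
  rangeSum (λ i → g (i + D)) 0 (suc q)      ≡⟨ rangeSum-shift g 0 D (suc q) ⟨
  rangeSum g D (suc q)                      ≤⟨ rangeSum-⊆ g D (suc q) (suc q + len) (≤-trans (≤-reflexive (+-comm D (suc q))) (+-monoʳ-≤ (suc q) D≤len)) ⟩
  rangeSum g 0 (suc q + len)                ≡⟨ rangeSum-+ g 0 (suc q) len ⟩
  G + rangeSum g (suc q) len                ∎)
  where
  open ≤-Reasoning
  G = rangeSum g 0 (suc q)

-- Binomial coefficients

[k+1]*[n+1]C[k+1]≡[n+1]*nCk : ∀ n k → suc k * (suc n C suc k) ≡ suc n * (n C k)
[k+1]*[n+1]C[k+1]≡[n+1]*nCk zero zero = refl
[k+1]*[n+1]C[k+1]≡[n+1]*nCk zero (suc k) =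
  trans (cong (suc (suc k) *_) (sym (nCk+nC[k+1]≡[n+1]C[k+1] 0 (suc k)))) (*-zeroʳ (suc (suc k)))
[k+1]*[n+1]C[k+1]≡[n+1]*nCk (suc n) zero = begin
  suc (suc n) C 1 + 0   ≡⟨ +-identityʳ _ ⟩
  suc (suc n) C 1       ≡⟨ nC1≡n (suc (suc n)) ⟩
  suc (suc n)           ≡⟨ *-identityʳ (suc (suc n)) ⟨
  suc (suc n) * 1       ∎
  where open ≡-Reasoning
[k+1]*[n+1]C[k+1]≡[n+1]*nCk (suc n) (suc k) = begin
  suc (suc k) * (suc (suc n) C suc (suc k))
    ≡⟨ cong (suc (suc k) *_) (nCk+nC[k+1]≡[n+1]C[k+1] (suc n) (suc k)) ⟨
  suc (suc k) * (suc n C suc k + suc n C suc (suc k))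
    ≡⟨ solve 3 (λ k a b → (con 2 :+ k) :* (a :+ b) := a :+ ((con 1 :+ k) :* a) :+ ((con 2 :+ k) :* b)) refl k (suc n C suc k) (suc n C suc (suc k)) ⟩
  suc n C suc k + suc k * (suc n C suc k) + suc (suc k) * (suc n C suc (suc k))
    ≡⟨ cong₂ (λ a b → suc n C suc k + a + b) ([k+1]*[n+1]C[k+1]≡[n+1]*nCk n k) ([k+1]*[n+1]C[k+1]≡[n+1]*nCk n (suc k)) ⟩
  suc n C suc k + suc n * (n C k) + suc n * (n C suc k)
    ≡⟨ trans (+-assoc (suc n C suc k) _ _) (cong (suc n C suc k +_) (sym (*-distribˡ-+ (suc n) (n C k) (n C suc k)))) ⟩
  suc n C suc k + suc n * (n C k + n C suc k)
    ≡⟨ cong (λ z → suc n C suc k + suc n * z) (nCk+nC[k+1]≡[n+1]C[k+1] n k) ⟩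
  suc (suc n) * (suc n C suc k) ∎
  where open ≡-Reasoning

[k+1]*nC[k+1]+k*nCk≡n*nCk : ∀ n k → suc k * (n C suc k) + k * (n C k) ≡ n * (n C k)
[k+1]*nC[k+1]+k*nCk≡n*nCk zero zero = refl
[k+1]*nC[k+1]+k*nCk≡n*nCk zero (suc k) = cong₂ _+_ (*-zeroʳ (suc (suc k))) (*-zeroʳ (suc k))
[k+1]*nC[k+1]+k*nCk≡n*nCk (suc n) zero = trans (+-identityʳ _) ([k+1]*[n+1]C[k+1]≡[n+1]*nCk n 0)
[k+1]*nC[k+1]+k*nCk≡n*nCk (suc n) (suc k) = begin
  suc (suc k) * (suc n C suc (suc k)) + suc k * (suc n C suc k)
    ≡⟨ cong₂ _+_ ([k+1]*[n+1]C[k+1]≡[n+1]*nCk n (suc k)) ([k+1]*[n+1]C[k+1]≡[n+1]*nCk n k) ⟩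
  suc n * (n C suc k) + suc n * (n C k)
    ≡⟨ *-distribˡ-+ (suc n) (n C suc k) (n C k) ⟨
  suc n * (n C suc k + n C k)
    ≡⟨ cong (suc n *_) (trans (+-comm (n C suc k) (n C k)) (nCk+nC[k+1]≡[n+1]C[k+1] n k)) ⟩
  suc n * (suc n C suc k) ∎
  where open ≡-Reasoning

nC[k+1]*[k+1]≡nCk*[n∸k] : ∀ n k → (n C suc k) * suc k ≡ (n C k) * (n ∸ k)
nC[k+1]*[k+1]≡nCk*[n∸k] n k = begin
  (n C suc k) * suc k                                   ≡⟨ *-comm (n C suc k) (suc k) ⟩
  suc k * (n C suc k)                                   ≡⟨ m+n∸n≡m (suc k * (n C suc k)) (k * (n C k)) ⟨
  suc k * (n C suc k) + k * (n C k) ∸ k * (n C k)       ≡⟨ cong (_∸ k * (n C k)) ([k+1]*nC[k+1]+k*nCk≡n*nCk n k) ⟩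
  n * (n C k) ∸ k * (n C k)                             ≡⟨ *-distribʳ-∸ (n C k) n k ⟨
  (n ∸ k) * (n C k)                                     ≡⟨ *-comm (n ∸ k) (n C k) ⟩
  (n C k) * (n ∸ k)                                     ∎
  where open ≡-Reasoning

nC[k+2]*[k+1]*[k+2]≡nCk*[n∸k]*[n∸k∸1] : ∀ n k →
  (n C suc (suc k)) * (suc k * suc (suc k)) ≡ (n C k) * ((n ∸ k) * (n ∸ suc k))
nC[k+2]*[k+1]*[k+2]≡nCk*[n∸k]*[n∸k∸1] n k = begin
  (n C suc (suc k)) * (suc k * suc (suc k))   ≡⟨ *-CS.x∙yz≈xz∙y (n C suc (suc k)) (suc k) (suc (suc k)) ⟩
  (n C suc (suc k)) * suc (suc k) * suc k     ≡⟨ cong (_* suc k) (nC[k+1]*[k+1]≡nCk*[n∸k] n (suc k)) ⟩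
  (n C suc k) * (n ∸ suc k) * suc k           ≡⟨ *-CS.xy∙z≈xz∙y (n C suc k) (n ∸ suc k) (suc k) ⟩
  (n C suc k) * suc k * (n ∸ suc k)           ≡⟨ cong (_* (n ∸ suc k)) (nC[k+1]*[k+1]≡nCk*[n∸k] n k) ⟩
  (n C k) * (n ∸ k) * (n ∸ suc k)             ≡⟨ *-assoc (n C k) _ _ ⟩
  (n C k) * ((n ∸ k) * (n ∸ suc k))           ∎
  where open ≡-Reasoning

[n+m+1]Cn*[m+1]≡[n+m]Cn*[n+m+1] : ∀ n m → ((n + suc m) C n) * suc m ≡ ((n + m) C n) * suc (n + m)
[n+m+1]Cn*[m+1]≡[n+m]Cn*[n+m+1] n m = begin
  ((n + suc m) C n) * suc m                   ≡⟨ cong (λ z → (z C n) * suc m) (+-suc n m) ⟩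
  (suc (n + m) C n) * suc m                   ≡⟨ cong ((suc (n + m) C n) *_) suc[n+m]∸n≡suc[m] ⟨
  (suc (n + m) C n) * (suc (n + m) ∸ n)       ≡⟨ nC[k+1]*[k+1]≡nCk*[n∸k] (suc (n + m)) n ⟨
  (suc (n + m) C suc n) * suc n               ≡⟨ *-comm _ (suc n) ⟩
  suc n * (suc (n + m) C suc n)               ≡⟨ [k+1]*[n+1]C[k+1]≡[n+1]*nCk (n + m) n ⟩
  suc (n + m) * ((n + m) C n)                 ≡⟨ *-comm (suc (n + m)) _ ⟩
  ((n + m) C n) * suc (n + m)                 ∎
  where
  open ≡-Reasoning
  suc[n+m]∸n≡suc[m] : suc (n + m) ∸ n ≡ suc m
  suc[n+m]∸n≡suc[m] = trans (+-∸-assoc 1 (m≤m+n n m)) (cong suc (m+n∸m≡n n m))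

-- Elementary estimates

-- Used with a ring identity as the equation: b − a = s + (Q − P) certifies a ≤ b.
≤-by-slack : ∀ {a b P Q} s → P ≤ Q → a + Q + s ≡ b + P → a ≤ b
≤-by-slack {a} {b} {P} {Q} s P≤Q e = +-cancelʳ-≤ Q a b (begin
  a + Q       ≤⟨ m≤m+n (a + Q) s ⟩
  a + Q + s   ≡⟨ e ⟩
  b + P       ≤⟨ +-monoʳ-≤ b P≤Q ⟩
  b + Q       ∎)
  where open ≤-Reasoning

m*m≤n*n⇒m≤n : ∀ {m n} → m * m ≤ n * n → m ≤ n
m*m≤n*n⇒m≤n {m} {n} m*m≤n*n with m ≤? n
... | yes m≤n = m≤n
... | no m≰n = contradiction m*m≤n*n (<⇒≱ (*-mono-< (≰⇒> m≰n) (≰⇒> m≰n)))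

sqrt-bracket : ∀ N → ∃ λ D → 1 ≤ D × suc N ≤ D * D × D * D ≤ 4 * suc N
sqrt-bracket zero = 1 , ≤-refl , ≤-refl , s≤s z≤n
sqrt-bracket (suc N) with sqrt-bracket N
... | D , 1≤D , lo , hi with suc (suc N) ≤? D * D
...   | yes lo′ = D , 1≤D , lo′ , ≤-trans hi (*-monoʳ-≤ 4 (n≤1+n (suc N)))
...   | no lo≰ = suc D , s≤s z≤n , lo′ , hi′
  where
  D*D≡ : D * D ≡ suc N
  D*D≡ = ≤-antisym (≤-pred (≰⇒> lo≰)) lo
  D≤N : D ≤ suc N
  D≤N = subst (D ≤_) D*D≡ (m≤m*n D D {{>-nonZero 1≤D}})
  square : suc D * suc D ≡ suc N + (D + D) + 1
  square = trans (solve 1 (λ D → (con 1 :+ D) :* (con 1 :+ D) := D :* D :+ (D :+ D) :+ con 1) refl D)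
                 (cong (λ z → z + (D + D) + 1) D*D≡)
  lo′ : suc (suc N) ≤ suc D * suc D
  lo′ = begin
    suc (suc N)          ≡⟨ +-comm 1 (suc N) ⟩
    suc N + 1            ≤⟨ +-monoˡ-≤ 1 (m≤m+n (suc N) (D + D)) ⟩
    suc N + (D + D) + 1  ≡⟨ square ⟨
    suc D * suc D        ∎
    where open ≤-Reasoning
  hi′ : suc D * suc D ≤ 4 * suc (suc N)
  hi′ = begin
    suc D * suc D                      ≡⟨ square ⟩
    suc N + (D + D) + 1                ≤⟨ +-monoˡ-≤ 1 (+-monoʳ-≤ (suc N) (+-mono-≤ D≤N D≤N)) ⟩
    suc N + (suc N + suc N) + 1        ≤⟨ m≤m+n _ (N + 4) ⟩
    suc N + (suc N + suc N) + 1 + (N + 4) ≡⟨ solve 1 (λ N → (con 1 :+ N) :+ ((con 1 :+ N) :+ (con 1 :+ N)) :+ con 1 :+ (N :+ con 4) := con 4 :* (con 2 :+ N)) refl N ⟩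
    4 * suc (suc N)                    ∎
    where open ≤-Reasoning

bernoulli : ∀ n D e → n ^ e * (n + e * D) ≤ (n + D) ^ e * n
bernoulli n D zero = ≤-reflexive (cong (1 *_) (+-identityʳ n))
bernoulli n D (suc e) = ≤-by-slack (n ^ e * e * D * D) (*-monoʳ-≤ (n + D) (bernoulli n D e))
  (solve 5 (λ n D p r e →
     n :* p :* (n :+ (con 1 :+ e) :* D) :+ (n :+ D) :* (r :* n) :+ p :* e :* D :* D
     := (n :+ D) :* r :* n :+ (n :+ D) :* (p :* (n :+ e :* D))) refl n D (n ^ e) ((n + D) ^ e) e)

[k+1]*n^D≤[n+D]^D : ∀ k n D .{{_ : NonZero n}} → suc k * n ≤ D * D → suc k * n ^ D ≤ (n + D) ^ D
[k+1]*n^D≤[n+D]^D k n D [k+1]n≤D² = *-cancelʳ-≤ _ _ n (begin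
  suc k * n ^ D * n        ≡⟨ solve 3 (λ k p n → k :* p :* n := p :* (k :* n)) refl (suc k) (n ^ D) n ⟩
  n ^ D * (suc k * n)      ≤⟨ *-monoʳ-≤ (n ^ D) (≤-trans [k+1]n≤D² (m≤n+m (D * D) n)) ⟩
  n ^ D * (n + D * D)      ≤⟨ bernoulli n D D ⟩
  (n + D) ^ D * n          ∎)
  where open ≤-Reasoning

module _ (g : ℕ → ℕ) (P Q : ℕ) where

  ratio-iterate-down : ∀ lo → (∀ j → lo ≤ j → g (suc j) * P ≤ g j * Q) →
                       ∀ e j → lo ≤ j → g (j + e) * P ^ e ≤ g j * Q ^ e
  ratio-iterate-down lo step zero j _ = ≤-reflexive (cong (λ z → g z * 1) (+-identityʳ j))
  ratio-iterate-down lo step (suc e) j lo≤j = begin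
    g (j + suc e) * (P * P ^ e)    ≡⟨ cong (λ z → g z * (P * P ^ e)) (+-suc j e) ⟩
    g (suc (j + e)) * (P * P ^ e)  ≡⟨ *-assoc (g (suc (j + e))) P (P ^ e) ⟨
    g (suc (j + e)) * P * P ^ e    ≤⟨ *-monoˡ-≤ (P ^ e) (step (j + e) (≤-trans lo≤j (m≤m+n j e))) ⟩
    g (j + e) * Q * P ^ e          ≡⟨ *-CS.xy∙z≈xz∙y (g (j + e)) Q (P ^ e) ⟩
    g (j + e) * P ^ e * Q          ≤⟨ *-monoˡ-≤ Q (ratio-iterate-down lo step e j lo≤j) ⟩
    g j * Q ^ e * Q                ≡⟨ *-CS.x∙yz≈xz∙y (g j) Q (Q ^ e) ⟨
    g j * (Q * Q ^ e)              ∎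
    where open ≤-Reasoning

  ratio-iterate-up : ∀ hi → (∀ j → suc j ≤ hi → g j * P ≤ g (suc j) * Q) →
                     ∀ e i → i + e ≤ hi → g i * P ^ e ≤ g (i + e) * Q ^ e
  ratio-iterate-up hi step zero i _ = ≤-reflexive (cong (λ z → g z * 1) (sym (+-identityʳ i)))
  ratio-iterate-up hi step (suc e) i i+e+1≤hi = begin
    g i * (P * P ^ e)              ≡⟨ *-CS.x∙yz≈xz∙y (g i) P (P ^ e) ⟩
    g i * P ^ e * P                ≤⟨ *-monoˡ-≤ P (ratio-iterate-up hi step e i (≤-trans (+-monoʳ-≤ i (n≤1+n e)) i+e+1≤hi)) ⟩
    g (i + e) * Q ^ e * P          ≡⟨ *-CS.xy∙z≈xz∙y (g (i + e)) (Q ^ e) P ⟩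
    g (i + e) * P * Q ^ e          ≤⟨ *-monoˡ-≤ (Q ^ e) (step (i + e) (subst (_≤ hi) (+-suc i e) i+e+1≤hi)) ⟩
    g (suc (i + e)) * Q * Q ^ e    ≡⟨ *-assoc (g (suc (i + e))) Q (Q ^ e) ⟩
    g (suc (i + e)) * (Q * Q ^ e)  ≡⟨ cong (λ z → g z * (Q * Q ^ e)) (+-suc i e) ⟨
    g (i + suc e) * (Q * Q ^ e)    ∎
    where open ≤-Reasoning

module _ (g : ℕ → ℕ) (k n D : ℕ) .{{_ : NonZero n}} ([k+1]n≤D² : suc k * n ≤ D * D) where

  decay-shift : ∀ lo → (∀ j → lo ≤ j → g (suc j) * (n + D) ≤ g j * n) →
                ∀ j → lo ≤ j → suc k * g (j + D) ≤ g j
  decay-shift lo step j lo≤j = *-cancelʳ-≤ _ _ (n ^ D) {{m^n≢0 n D}} (begin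
    suc k * g (j + D) * n ^ D      ≡⟨ solve 3 (λ k a p → k :* a :* p := a :* (k :* p)) refl (suc k) (g (j + D)) (n ^ D) ⟩
    g (j + D) * (suc k * n ^ D)    ≤⟨ *-monoʳ-≤ (g (j + D)) ([k+1]*n^D≤[n+D]^D k n D [k+1]n≤D²) ⟩
    g (j + D) * (n + D) ^ D        ≤⟨ ratio-iterate-down g (n + D) n lo step D j lo≤j ⟩
    g j * n ^ D                    ∎)
    where open ≤-Reasoning

  growth-shift : ∀ hi → (∀ j → suc j ≤ hi → g j * (n + D) ≤ g (suc j) * n) →
                 ∀ i → i + D ≤ hi → suc k * g i ≤ g (i + D)
  growth-shift hi step i i+D≤hi = *-cancelʳ-≤ _ _ (n ^ D) {{m^n≢0 n D}} (begin
    suc k * g i * n ^ D            ≡⟨ solve 3 (λ k a p → k :* a :* p := a :* (k :* p)) refl (suc k) (g i) (n ^ D) ⟩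
    g i * (suc k * n ^ D)          ≤⟨ *-monoʳ-≤ (g i) ([k+1]*n^D≤[n+D]^D k n D [k+1]n≤D²) ⟩
    g i * (n + D) ^ D              ≤⟨ ratio-iterate-up g (n + D) n hi step D i i+D≤hi ⟩
    g (i + D) * n ^ D              ∎)
    where open ≤-Reasoning

-- Classes of configurations

halve-parity : ∀ q r w s → r ≤ 1 → 2 * q + r + w ≡ 2 * s → ∃ λ i → w ≡ r + 2 * i × s ≡ q + r + i
halve-parity q r w s r≤1 e with fromParityHalf-surjective w
halve-parity q zero _ s _ e | inside , u , refl =
  u , refl , *-cancelˡ-≡ _ _ 2 (trans (sym e) (solve 2 (λ q u → con 2 :* q :+ con 0 :+ con 2 :* u := con 2 :* (q :+ con 0 :+ u)) refl q u))
halve-parity q zero _ s _ e | outside , u , refl =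
  contradiction (trans (sym e) (solve 2 (λ q u → con 2 :* q :+ con 0 :+ (con 1 :+ con 2 :* u) := con 1 :+ con 2 :* (q :+ u)) refl q u)) (even≢odd s (q + u))
halve-parity q (suc zero) _ s _ e | inside , u , refl =
  contradiction (trans (sym e) (solve 2 (λ q u → con 2 :* q :+ con 1 :+ con 2 :* u := con 1 :+ con 2 :* (q :+ u)) refl q u)) (even≢odd s (q + u))
halve-parity q (suc zero) _ s _ e | outside , u , refl =
  u , refl , *-cancelˡ-≡ _ _ 2 (trans (sym e) (solve 2 (λ q u → con 2 :* q :+ con 1 :+ (con 1 :+ con 2 :* u) := con 2 :* (q :+ con 1 :+ u)) refl q u))
halve-parity q (suc (suc r)) w s (s≤s ()) e | _

-- Class i consists of the configurations of t = n + a pebbles with r + 2i even vertices: the set S of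
-- these vertices together with the halves ⌊c_v/2⌋, which then sum to q + r + i.
module Classes (n′ q r : ℕ) (r≤1 : r ≤ 1) where

  n = suc n′
  a = 2 * q + r
  t = n + a

  evensOf : ℕ → ℕ
  evensOf i = r + 2 * i

  halvesOf : ℕ → ℕ
  halvesOf i = q + r + i

  class : ℕ → List (Vec ℕ n)
  class i = cartesianProductWith assemble (subsetsOfSize n (evensOf i)) (compositions n (halvesOf i))

  classSize : ℕ → ℕ
  classSize i = (n C evensOf i) * ((n′ + halvesOf i) C n′)

  length-class : ∀ i → length (class i) ≡ classSize i
  length-class i = trans (length-cartesianProductWith assemble (subsetsOfSize n (evensOf i)) (compositions n (halvesOf i)))
                         (cong₂ _*_ (length-subsetsOfSize n (evensOf i)) (length-compositions n′ (halvesOf i)))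

  class-unique : ∀ i → Unique (class i)
  class-unique i = Unique.cartesianProductWith⁺ assemble assemble-injective
                     (subsetsOfSize-unique n (evensOf i)) (compositions-unique n (halvesOf i))

  ∈-class⁻ : ∀ i {c} → c ∈ class i → sum c ≡ t × evens c ≡ evensOf i
  ∈-class⁻ i c∈ with ∈-cartesianProductWith⁻ assemble (subsetsOfSize n (evensOf i)) (compositions n (halvesOf i)) c∈
  ... | S , h , S∈ , h∈ , refl = +-cancelʳ-≡ (evensOf i) _ _ sum+evens , trans (evens-assemble S h) ∣S∣≡
    where
    ∣S∣≡ = ∈-subsetsOfSize⁻ n (evensOf i) S∈
    sum+evens : sum (assemble S h) + evensOf i ≡ t + evensOf i
    sum+evens = begin
      sum (assemble S h) + evensOf i   ≡⟨ cong (sum (assemble S h) +_) ∣S∣≡ ⟨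
      sum (assemble S h) + ∣ S ∣       ≡⟨ sum-assemble S h ⟩
      2 * sum h + n                    ≡⟨ cong (λ z → 2 * z + n) (∈-compositions⁻ n (halvesOf i) h∈) ⟩
      2 * (q + r + i) + n              ≡⟨ solve 4 (λ q r i n → con 2 :* (q :+ r :+ i) :+ n := n :+ (con 2 :* q :+ r) :+ (r :+ con 2 :* i)) refl q r i n ⟩
      t + evensOf i                    ∎
      where open ≡-Reasoning

  ∈-class⁺ : ∀ (v : Vec ℕ n) → sum v ≡ t → ∃ λ i → i ≤ n × v ∈ class i
  ∈-class⁺ v sum≡t with assemble-surjective v
  ... | S , h , refl with halve-parity q r ∣ S ∣ (sum h) r≤1 a+∣S∣≡2*sum-h
    where
    a+∣S∣≡2*sum-h : a + ∣ S ∣ ≡ 2 * sum h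
    a+∣S∣≡2*sum-h = +-cancelˡ-≡ n _ _ (begin
      n + (a + ∣ S ∣)                ≡⟨ +-assoc n a ∣ S ∣ ⟨
      t + ∣ S ∣                      ≡⟨ cong (_+ ∣ S ∣) sum≡t ⟨
      sum (assemble S h) + ∣ S ∣     ≡⟨ sum-assemble S h ⟩
      2 * sum h + n                  ≡⟨ +-comm (2 * sum h) n ⟩
      n + 2 * sum h                  ∎)
      where open ≡-Reasoning
  ... | i , ∣S∣≡ , sum-h≡ = i , i≤n , ∈-cartesianProductWith⁺ assemble
                                        (∈-subsetsOfSize⁺ S ∣S∣≡) (∈-compositions⁺ h sum-h≡)
    where
    i≤n : i ≤ n
    i≤n = begin
      i          ≤⟨ m≤m+n i (i + 0) ⟩
      2 * i      ≤⟨ m≤n+m (2 * i) r ⟩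
      r + 2 * i  ≡⟨ ∣S∣≡ ⟨
      ∣ S ∣      ≤⟨ ∣p∣≤n S ⟩
      n          ∎
      where open ≤-Reasoning

  classIndex : Vec ℕ n → ℕ
  classIndex c = ⌊ (evens c ∸ r) /2⌋

  classIndex-class : ∀ i {c} → c ∈ class i → classIndex c ≡ i
  classIndex-class i {c} c∈ = begin
    ⌊ (evens c ∸ r) /2⌋        ≡⟨ cong (λ e → ⌊ (e ∸ r) /2⌋) (proj₂ (∈-class⁻ i c∈)) ⟩
    ⌊ (r + 2 * i ∸ r) /2⌋      ≡⟨ cong ⌊_/2⌋ (trans (m+n∸m≡n r (2 * i)) (cong (i +_) (+-identityʳ i))) ⟩
    ⌊ (i + i) /2⌋              ≡⟨ n≡⌊n+n/2⌋ i ⟨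
    i                          ∎
    where open ≡-Reasoning

  good bad : List (Vec ℕ n)
  good = concatRange class 0 (suc q)
  bad = concatRange class (suc q) n

  good-unique : Unique good
  good-unique = concatRange-unique class classIndex class-unique classIndex-class 0 (suc q)

  bad-unique : Unique bad
  bad-unique = concatRange-unique class classIndex class-unique classIndex-class (suc q) n

  length-good : length good ≡ rangeSum classSize 0 (suc q)
  length-good = trans (length-concatRange class 0 (suc q)) (rangeSum-cong length-class 0 (suc q))

  length-bad : length bad ≡ rangeSum classSize (suc q) n
  length-bad = trans (length-concatRange class (suc q) n) (rangeSum-cong length-class (suc q) n)

  ∈-good⁻ : ∀ {c} → c ∈ good → sum c ≡ t × evens c ≤ a
  ∈-good⁻ {c} c∈ with ∈-concatRange⁻ class 0 (suc q) c∈
  ... | i , _ , i<q+1 , c∈i with ∈-class⁻ i c∈i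
  ...   | sum≡t , evens≡ = sum≡t , (begin
    evens c        ≡⟨ evens≡ ⟩
    r + 2 * i      ≤⟨ +-monoʳ-≤ r (*-monoʳ-≤ 2 (≤-pred i<q+1)) ⟩
    r + 2 * q      ≡⟨ +-comm r (2 * q) ⟩
    a              ∎)
    where open ≤-Reasoning

  ∈-bad⁻ : ∀ {c} → c ∈ bad → sum c ≡ t × a < evens c
  ∈-bad⁻ {c} c∈ with ∈-concatRange⁻ class (suc q) n c∈
  ... | i , q+1≤i , _ , c∈i with ∈-class⁻ i c∈i
  ...   | sum≡t , evens≡ = sum≡t , (begin-strict
    a              ≡⟨ +-comm (2 * q) r ⟩
    r + 2 * q      <⟨ +-monoʳ-< r (*-monoʳ-< 2 q+1≤i) ⟩
    r + 2 * i      ≡⟨ evens≡ ⟨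
    evens c        ∎)
    where open ≤-Reasoning

  ∈-good++bad : ∀ (v : Vec ℕ n) → sum v ≡ t → v ∈ good ++ bad
  ∈-good++bad v sum≡t with ∈-class⁺ v sum≡t
  ... | i , i≤n , v∈i with i ≤? q
  ...   | yes i≤q = ∈-++⁺ˡ (∈-concatRange⁺ class z≤n (s≤s i≤q) v∈i)
  ...   | no i≰q = ∈-++⁺ʳ good (∈-concatRange⁺ class (≰⇒> i≰q) (s≤s (≤-trans i≤n (m≤n+m n q))) v∈i)

  total≤good+bad : total n t ≤ rangeSum classSize 0 (suc q) + rangeSum classSize (suc q) n
  total≤good+bad = begin
    (n′ + t) C n′                            ≡⟨ length-compositions n′ t ⟨
    length (compositions n t)                ≤⟨ unique-⊆⇒length≤ (compositions-unique n t) (λ {v} v∈ → ∈-good++bad v (∈-compositions⁻ n t v∈)) ⟩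
    length (good ++ bad)                     ≡⟨ length-++ good ⟩
    length good + length bad                 ≡⟨ cong₂ _+_ length-good length-bad ⟩
    rangeSum classSize 0 (suc q) + rangeSum classSize (suc q) n ∎
    where open ≤-Reasoning

  classSize-ratio : ∀ i → let w = evensOf i; m = halvesOf i in
    classSize (suc i) * (suc w * suc (suc w) * suc m) ≡ classSize i * ((n ∸ w) * (n ∸ suc w) * (m + n))
  classSize-ratio i = begin
    classSize (suc i) * (suc w * suc (suc w) * suc m)
      ≡⟨ cong₂ (λ u v → (n C u) * ((n′ + v) C n′) * (suc w * suc (suc w) * suc m)) evensOf-suc (+-suc (q + r) i) ⟩
    (n C suc (suc w)) * ((n′ + suc m) C n′) * (suc w * suc (suc w) * suc m)
      ≡⟨ solve 5 (λ A H a b c → (A :* H) :* (a :* b :* c) := (A :* (a :* b)) :* (H :* c)) refl (n C suc (suc w)) ((n′ + suc m) C n′) (suc w) (suc (suc w)) (suc m) ⟩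
    ((n C suc (suc w)) * (suc w * suc (suc w))) * (((n′ + suc m) C n′) * suc m)
      ≡⟨ cong₂ _*_ (nC[k+2]*[k+1]*[k+2]≡nCk*[n∸k]*[n∸k∸1] n w) ([n+m+1]Cn*[m+1]≡[n+m]Cn*[n+m+1] n′ m) ⟩
    ((n C w) * ((n ∸ w) * (n ∸ suc w))) * (((n′ + m) C n′) * suc (n′ + m))
      ≡⟨ solve 6 (λ A H x y n′ m → (A :* (x :* y)) :* (H :* (con 1 :+ (n′ :+ m))) := (A :* H) :* (x :* y :* (m :+ (con 1 :+ n′)))) refl (n C w) ((n′ + m) C n′) (n ∸ w) (n ∸ suc w) n′ m ⟩
    classSize i * ((n ∸ w) * (n ∸ suc w) * (m + n))
      ∎
    where
    open ≡-Reasoning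
    w = evensOf i
    m = halvesOf i
    evensOf-suc : evensOf (suc i) ≡ suc (suc w)
    evensOf-suc = solve 2 (λ r i → r :+ con 2 :* (con 1 :+ i) := con 2 :+ (r :+ con 2 :* i)) refl r i

-- Ratio bounds at the threshold

-- The golden ratio γ is the positive root of t² − t n − n², so t ≷ γ n is measured by this quadratic.
GapAbove GapBelow : ℕ → ℕ → ℕ → Set
GapAbove n t X = t * n + n * n + X ≤ t * t
GapBelow n t X = t * t + X ≤ n * n + t * n

-- Certificate: n² · (the hypothesis) + D (n − D) (5y² + 8xy + 4x²) + a polynomial with nonnegative coefficients.
decay-polynomial : ∀ x y D → let n = x + y in D ≤ n → GapAbove n (x + 2 * D + n) (24 * D * n) →
  y * y * (x + D + n) * (n + D) ≤ x * x * (x + D) * n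
decay-polynomial x y D D≤n gap = ≤-by-slack S P≤Q (solve 3 (λ x y D →
     y :* y :* (x :+ D :+ N x y) :* (N x y :+ D)
       :+ (N x y :* N x y :* (T x y D :* T x y D) :+ D :* N x y :* E x y) :+ S′ x y D
  := x :* x :* (x :+ D) :* N x y
       :+ (N x y :* N x y :* (T x y D :* N x y :+ N x y :* N x y :+ con 24 :* D :* N x y) :+ D :* D :* E x y))
  refl x y D)
  where
  N = λ x y → x :+ y
  T = λ x y D → x :+ con 2 :* D :+ (x :+ y)
  E = λ x y → con 5 :* y :* y :+ con 8 :* x :* y :+ con 4 :* x :* x
  S′ = λ x y D → con 15 :* y :* y :* y :* D :+ con 46 :* x :* y :* y :* D :+ con 47 :* x :* x :* y :* D :+ con 15 :* x :* x :* x :* D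
  n = x + y
  t = x + 2 * D + n
  e = 5 * y * y + 8 * x * y + 4 * x * x
  S = 15 * y * y * y * D + 46 * x * y * y * D + 47 * x * x * y * D + 15 * x * x * x * D
  P≤Q : n * n * (t * n + n * n + 24 * D * n) + D * D * e ≤ n * n * (t * t) + D * n * e
  P≤Q = +-mono-≤ (*-monoʳ-≤ (n * n) gap) (*-monoˡ-≤ e (*-monoʳ-≤ D D≤n))

-- Certificate: n² · (the hypothesis) + a polynomial with nonnegative coefficients.
growth-polynomial : ∀ a y D → let n = a + 2 * D + y in GapBelow n (n + a) (24 * D * n) →
  (a + 2 * D) * (a + 2 * D) * (a + D) * (n + D) ≤ y * y * (n + a) * n
growth-polynomial a y D gap = ≤-by-slack S (*-monoʳ-≤ (n * n) gap) (solve 3 (λ a y D →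
     (a :+ con 2 :* D) :* (a :+ con 2 :* D) :* (a :+ D) :* (N a y D :+ D)
       :+ N a y D :* N a y D :* (N a y D :* N a y D :+ (N a y D :+ a) :* N a y D) :+ S′ a y D
  := y :* y :* (N a y D :+ a) :* N a y D
       :+ N a y D :* N a y D :* ((N a y D :+ a) :* (N a y D :+ a) :+ con 24 :* D :* N a y D))
  refl a y D)
  where
  N = λ a y D → a :+ con 2 :* D :+ y
  S′ = λ a y D → con 164 :* D :* D :* D :* D :+ con 252 :* y :* D :* D :* D :+ con 124 :* y :* y :* D :* D :+ con 20 :* y :* y :* y :* D :+ con 236 :* a :* D :* D :* D :+ con 244 :* a :* y :* D :* D :+ con 60 :* a :* y :* y :* D :+ con 113 :* a :* a :* D :* D :+ con 59 :* a :* a :* y :* D :+ con 18 :* a :* a :* a :* D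
  n = a + 2 * D + y
  S = 164 * D * D * D * D + 252 * y * D * D * D + 124 * y * y * D * D + 20 * y * y * y * D + 236 * a * D * D * D + 244 * a * y * D * D + 60 * a * y * y * D + 113 * a * a * D * D + 59 * a * a * y * D + 18 * a * a * a * D

decay-threshold : ∀ n D x → D ≤ n → GapAbove n (x + 2 * D + n) (24 * D * n) →
  (n ∸ x) * (n ∸ x) * (x + D + n) * (n + D) ≤ x * x * (x + D) * n
decay-threshold n D x D≤n gap with x ≤? n
... | no x≰n rewrite m≤n⇒m∸n≡0 (<⇒≤ (≰⇒> x≰n)) = z≤n
... | yes x≤n with n ∸ x | m+[n∸m]≡n x≤n
...   | y | refl = decay-polynomial x y D D≤n gap

growth-threshold : ∀ n D a → a + 2 * D ≤ n → GapBelow n (n + a) (24 * D * n) →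
  (a + 2 * D) * (a + 2 * D) * (a + D) * (n + D) ≤ (n ∸ (a + 2 * D)) * (n ∸ (a + 2 * D)) * (n + a) * n
growth-threshold n D a a+2D≤n gap with n ∸ (a + 2 * D) | m+[n∸m]≡n a+2D≤n
... | y | refl = growth-polynomial a y D gap

decay-ratio : ∀ n D x w m → 1 ≤ x + D → x ≤ w → x + D ≤ m →
  (n ∸ x) * (n ∸ x) * (x + D + n) * (n + D) ≤ x * x * (x + D) * n →
  (n ∸ w) * (n ∸ suc w) * (m + n) * (n + D) ≤ suc w * suc (suc w) * suc m * n
decay-ratio n D x w m 1≤x+D x≤w x+D≤m at-x = *-cancelʳ-≤ _ _ (x + D) {{>-nonZero 1≤x+D}} (begin
  (n ∸ w) * (n ∸ suc w) * (m + n) * (n + D) * (x + D)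
    ≤⟨ *-monoˡ-≤ (x + D) (*-monoˡ-≤ (n + D) (*-monoˡ-≤ (m + n) (*-mono-≤ (∸-monoʳ-≤ n x≤w) (∸-monoʳ-≤ n x≤1+w)))) ⟩
  y * y * (m + n) * (n + D) * (x + D)
    ≡⟨ solve 5 (λ y m n D u → y :* y :* (m :+ n) :* (n :+ D) :* u := (y :* y :* (n :+ D)) :* ((m :+ n) :* u)) refl y m n D (x + D) ⟩
  y * y * (n + D) * ((m + n) * (x + D))
    ≤⟨ *-monoʳ-≤ (y * y * (n + D)) m+n/m+1-antitone ⟩
  y * y * (n + D) * ((x + D + n) * suc m)
    ≡⟨ solve 5 (λ y m n D u → (y :* y :* (n :+ D)) :* ((u :+ n) :* (con 1 :+ m)) := (y :* y :* (u :+ n) :* (n :+ D)) :* (con 1 :+ m)) refl y m n D (x + D) ⟩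
  y * y * (x + D + n) * (n + D) * suc m
    ≤⟨ *-monoˡ-≤ (suc m) at-x ⟩
  x * x * (x + D) * n * suc m
    ≤⟨ *-monoˡ-≤ (suc m) (*-monoˡ-≤ n (*-monoˡ-≤ (x + D) (*-mono-≤ x≤1+w (≤-trans x≤1+w (n≤1+n (suc w)))))) ⟩
  suc w * suc (suc w) * (x + D) * n * suc m
    ≡⟨ solve 5 (λ a b u n m → a :* b :* u :* n :* (con 1 :+ m) := a :* b :* (con 1 :+ m) :* n :* u) refl (suc w) (suc (suc w)) (x + D) n m ⟩
  suc w * suc (suc w) * suc m * n * (x + D) ∎)
  where
  open ≤-Reasoning
  y = n ∸ x
  x≤1+w = ≤-trans x≤w (n≤1+n w)
  m+n/m+1-antitone : (m + n) * (x + D) ≤ (x + D + n) * suc m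
  m+n/m+1-antitone = ≤-by-slack (x + D + n) (*-monoʳ-≤ n x+D≤m)
    (solve 3 (λ m n u → (m :+ n) :* u :+ n :* m :+ (u :+ n) := (u :+ n) :* (con 1 :+ m) :+ n :* u) refl m n (x + D))

growth-ratio : ∀ n′ D w m W M t → let n = suc n′ in 1 ≤ t → suc (suc w) ≤ W → suc m ≤ M → t ≤ M + n′ →
  W * W * M * (n + D) ≤ (n ∸ W) * (n ∸ W) * t * n →
  suc w * suc (suc w) * suc m * (n + D) ≤ (n ∸ w) * (n ∸ suc w) * (m + n) * n
growth-ratio n′ D w m W M t 1≤t w+2≤W m+1≤M t≤M+n′ at-W = *-cancelʳ-≤ _ _ t {{>-nonZero 1≤t}} (begin
  suc w * suc (suc w) * suc m * (n + D) * t
    ≤⟨ *-monoˡ-≤ t (*-monoˡ-≤ (n + D) (*-monoˡ-≤ (suc m) (*-mono-≤ (≤-trans (n≤1+n (suc w)) w+2≤W) w+2≤W))) ⟩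
  W * W * suc m * (n + D) * t
    ≡⟨ solve 4 (λ W m e t → W :* W :* (con 1 :+ m) :* e :* t := (W :* W :* e) :* ((con 1 :+ m) :* t)) refl W m (n + D) t ⟩
  W * W * (n + D) * (suc m * t)
    ≤⟨ *-monoʳ-≤ (W * W * (n + D)) m+n/m+1-antitone ⟩
  W * W * (n + D) * (M * (m + n))
    ≡⟨ solve 4 (λ W e M u → (W :* W :* e) :* (M :* u) := (W :* W :* M :* e) :* u) refl W (n + D) M (m + n) ⟩
  W * W * M * (n + D) * (m + n)
    ≤⟨ *-monoˡ-≤ (m + n) at-W ⟩
  (n ∸ W) * (n ∸ W) * t * n * (m + n)
    ≤⟨ *-monoˡ-≤ (m + n) (*-monoˡ-≤ n (*-monoˡ-≤ t (*-mono-≤ (∸-monoʳ-≤ n w≤W) (∸-monoʳ-≤ n (≤-trans (n≤1+n (suc w)) w+2≤W))))) ⟩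
  (n ∸ w) * (n ∸ suc w) * t * n * (m + n)
    ≡⟨ solve 5 (λ a b t n u → a :* b :* t :* n :* u := a :* b :* u :* n :* t) refl (n ∸ w) (n ∸ suc w) t n (m + n) ⟩
  (n ∸ w) * (n ∸ suc w) * (m + n) * n * t ∎)
  where
  open ≤-Reasoning
  n = suc n′
  w≤W = ≤-trans (n≤1+n w) (≤-trans (n≤1+n (suc w)) w+2≤W)
  m+n/m+1-antitone : suc m * t ≤ M * (m + n)
  m+n/m+1-antitone = begin
    suc m * t                       ≤⟨ *-monoʳ-≤ (suc m) t≤M+n′ ⟩
    suc m * (M + n′)                ≡⟨ cong (λ z → suc m * (z + n′)) (m+[n∸m]≡n m+1≤M) ⟨
    suc m * (suc m + d + n′)        ≤⟨ m≤m+n _ (d * n′) ⟩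
    suc m * (suc m + d + n′) + d * n′ ≡⟨ solve 3 (λ p d n′ → p :* (p :+ d :+ n′) :+ d :* n′ := (p :+ d) :* (p :+ n′)) refl (suc m) d n′ ⟩
    (suc m + d) * (suc m + n′)      ≡⟨ cong₂ _*_ (m+[n∸m]≡n m+1≤M) (sym (+-suc m n′)) ⟩
    M * (m + n)                     ∎
    where d = M ∸ suc m

-- The golden-ratio hypotheses over ℕ

-- Scoped, because the constructor +_ of ℤ clashes with sections of _+_ on ℕ.
module _ where

  open import Data.Integer as ℤ using (+_; -[1+_]; -_; 0ℤ; +≤+)
  import Data.Integer.Properties as ℤ

  nonNegSurd⇒ : ∀ {a b c} → NonNegSurd a b c → b ℤ.≤ 0ℤ → 0ℤ ℤ.≤ a × b ℤ.* b ℤ.* + c ℤ.≤ a ℤ.* a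
  nonNegSurd⇒ {+ a} (inj₁ (0≤a , 0≤b)) b≤0 with ℤ.≤-antisym b≤0 0≤b
  ... | refl = 0≤a , subst (0ℤ ℤ.≤_) (ℤ.pos-* a a) (+≤+ z≤n)
  nonNegSurd⇒ (inj₂ (inj₁ (0≤a , _ , b²c≤a²))) _ = 0≤a , b²c≤a²
  nonNegSurd⇒ {+ a} (inj₂ (inj₂ (ℤ.+<+ () , _ , _))) _
  -- a < 0 ≤ b ≤ 0 forces b = 0, and then a² ≤ 0 is impossible.
  nonNegSurd⇒ { -[1+ a ]} (inj₂ (inj₂ (_ , 0≤b , a²≤b²c))) b≤0 with ℤ.≤-antisym b≤0 0≤b
  nonNegSurd⇒ { -[1+ a ]} (inj₂ (inj₂ (_ , _ , +≤+ ()))) _ | refl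

  0≤+m-+n⇒n≤m : ∀ {m n} → 0ℤ ℤ.≤ + m ℤ.- + n → n ≤ m
  0≤+m-+n⇒n≤m 0≤m-n = ℤ.drop‿+≤+ (ℤ.0≤i-j⇒j≤i 0≤m-n)

  +m-+n≡+[m∸n] : ∀ {m n} → n ≤ m → + m ℤ.- + n ≡ + (m ∸ n)
  +m-+n≡+[m∸n] {m} {n} n≤m = trans (ℤ.m-n≡m⊖n m n) (ℤ.⊖-≥ n≤m)

  private
    -i*-i≡i*i : ∀ i → (- i) ℤ.* (- i) ≡ i ℤ.* i
    -i*-i≡i*i i = begin
      (- i) ℤ.* (- i)    ≡⟨ ℤ.neg-distribˡ-* i (- i) ⟨
      - (i ℤ.* (- i))    ≡⟨ cong -_ (ℤ.neg-distribʳ-* i i) ⟨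
      - (- (i ℤ.* i))    ≡⟨ ℤ.neg-involutive (i ℤ.* i) ⟩
      i ℤ.* i            ∎
      where open ≡-Reasoning

    pos-4MA : ∀ M A → + (4 * M * A) ≡ + 4 ℤ.* + M ℤ.* + A
    pos-4MA M A = trans (ℤ.pos-* (4 * M) A) (cong (ℤ._* + A) (ℤ.pos-* 4 M))

    pos-A²+4M²n : ∀ A M n → + (A * A + 4 * M * M * n) ≡ + A ℤ.* + A ℤ.+ + 4 ℤ.* + M ℤ.* + M ℤ.* + n
    pos-A²+4M²n A M n = trans (ℤ.pos-+ (A * A) (4 * M * M * n)) (cong₂ ℤ._+_ (ℤ.pos-* A A)
      (trans (ℤ.pos-* (4 * M * M) n) (cong (ℤ._* + n) (pos-4MA M M))))

    pos-5n² : ∀ n → + (5 * n * n) ≡ + 5 ℤ.* + n ℤ.* + n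
    pos-5n² n = trans (ℤ.pos-* (5 * n) n) (cong (ℤ._* + n) (ℤ.pos-* 5 n))

    pos-[4MA]²n : ∀ M A n → + ((4 * M * A) * (4 * M * A) * n) ≡ (- (+ 4 ℤ.* + M ℤ.* + A)) ℤ.* (- (+ 4 ℤ.* + M ℤ.* + A)) ℤ.* + n
    pos-[4MA]²n M A n = trans (ℤ.pos-* ((4 * M * A) * (4 * M * A)) n) (cong (ℤ._* + n) (begin
      + ((4 * M * A) * (4 * M * A))               ≡⟨ ℤ.pos-* (4 * M * A) (4 * M * A) ⟩
      + (4 * M * A) ℤ.* + (4 * M * A)             ≡⟨ cong₂ ℤ._*_ (pos-4MA M A) (pos-4MA M A) ⟩
      (+ 4 ℤ.* + M ℤ.* + A) ℤ.* (+ 4 ℤ.* + M ℤ.* + A) ≡⟨ -i*-i≡i*i (+ 4 ℤ.* + M ℤ.* + A) ⟨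
      (- (+ 4 ℤ.* + M ℤ.* + A)) ℤ.* (- (+ 4 ℤ.* + M ℤ.* + A)) ∎))
      where open ≡-Reasoning

    -[4MA]≤0 : ∀ M A → - (+ 4 ℤ.* + M ℤ.* + A) ℤ.≤ 0ℤ
    -[4MA]≤0 M A = subst (λ z → - z ℤ.≤ 0ℤ) (pos-4MA M A) ℤ.neg-≤-pos

    i-j-k≡i-[j+k] : ∀ i j k → i ℤ.- j ℤ.- k ≡ i ℤ.- (j ℤ.+ k)
    i-j-k≡i-[j+k] i j k = trans (ℤ.+-assoc i (- j) (- k)) (cong (λ z → i ℤ.+ z) (sym (ℤ.neg-distrib-+ j k)))

    -[2M]≤0 : ∀ M → - (+ 2 ℤ.* + M) ℤ.≤ 0ℤ
    -[2M]≤0 M = subst (λ z → - z ℤ.≤ 0ℤ) (ℤ.pos-* 2 M) ℤ.neg-≤-pos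

  goldenAbove⇒ : ∀ {M n t} → GoldenAbove M n t → ∃₂ λ A B →
    A + n ≡ 2 * t × B + 5 * n * n ≡ A * A + 4 * M * M * n × (4 * M * A) * (4 * M * A) * n ≤ B * B
  goldenAbove⇒ {M} {n} {t} (surd₁ , surd₂) = A , B , m∸n+n≡m n≤2t , m∸n+n≡m 5n²≤ , [4MA]²n≤B²
    where
    n≤2t : n ≤ 2 * t
    n≤2t = 0≤+m-+n⇒n≤m (proj₁ (nonNegSurd⇒ surd₁ (-[2M]≤0 M)))
    A = 2 * t ∸ n
    surd : NonNegSurd (+ (A * A + 4 * M * M * n) ℤ.- + (5 * n * n)) (- (+ 4 ℤ.* + M ℤ.* + A)) n
    surd = subst₂ (λ a b → NonNegSurd a b n)
      (cong₂ ℤ._-_ (sym (pos-A²+4M²n A M n)) (sym (pos-5n² n)))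
      refl
      (subst (λ z → NonNegSurd (z ℤ.* z ℤ.+ + 4 ℤ.* + M ℤ.* + M ℤ.* + n ℤ.- + 5 ℤ.* + n ℤ.* + n) (- (+ 4 ℤ.* + M ℤ.* z)) n)
             (+m-+n≡+[m∸n] n≤2t) surd₂)
    bounds = nonNegSurd⇒ surd (-[4MA]≤0 M A)
    5n²≤ : 5 * n * n ≤ A * A + 4 * M * M * n
    5n²≤ = 0≤+m-+n⇒n≤m (proj₁ bounds)
    B = A * A + 4 * M * M * n ∸ 5 * n * n
    [4MA]²n≤B² : (4 * M * A) * (4 * M * A) * n ≤ B * B
    [4MA]²n≤B² = ℤ.drop‿+≤+ (subst₂ ℤ._≤_ (sym (pos-[4MA]²n M A n))
      (trans (cong (λ z → z ℤ.* z) (+m-+n≡+[m∸n] 5n²≤)) (sym (ℤ.pos-* B B))) (proj₂ bounds))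

  module _ {M n t : ℕ} (1≤n : 1 ≤ n) (n≤t : n ≤ t) where

    private
      n≤2t : n ≤ 2 * t
      n≤2t = ≤-trans n≤t (m≤m+n t (t + 0))
      A = 2 * t ∸ n
      A≡ : + (2 * t) ℤ.- + n ≡ + A
      A≡ = +m-+n≡+[m∸n] n≤2t
      1≤A : 1 ≤ A
      1≤A = begin
        1                  ≤⟨ ≤-trans 1≤n n≤t ⟩
        t                  ≡⟨ +-identityʳ t ⟨
        t + 0              ≡⟨ m+n∸m≡n t (t + 0) ⟨
        2 * t ∸ t          ≤⟨ ∸-monoʳ-≤ (2 * t) n≤t ⟩
        2 * t ∸ n          ∎
        where open ≤-Reasoning

    goldenBelow⇒ : GoldenBelow M n t → ∃₂ λ A B →
      A + n ≡ 2 * t × B + (A * A + 4 * M * M * n) ≡ 5 * n * n × (4 * M * A) * (4 * M * A) * n ≤ B * B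
    goldenBelow⇒ (inj₁ surd) = contradiction (subst (λ z → 0ℤ ℤ.≤ - z) A≡ (proj₁ (nonNegSurd⇒ surd (-[2M]≤0 M)))) (0≰-A 1≤A)
      where
      0≰-A : ∀ {a} → 1 ≤ a → ¬ (0ℤ ℤ.≤ - (+ a))
      0≰-A {suc a} _ ()
    goldenBelow⇒ (inj₂ surd₂) = A , B , m∸n+n≡m n≤2t , m∸n+n≡m A²+4M²n≤ , [4MA]²n≤B²
      where
      surd : NonNegSurd (+ (5 * n * n) ℤ.- + (A * A + 4 * M * M * n)) (- (+ 4 ℤ.* + M ℤ.* + A)) n
      surd = subst₂ (λ a b → NonNegSurd a b n)
        (trans (i-j-k≡i-[j+k] (+ 5 ℤ.* + n ℤ.* + n) (+ A ℤ.* + A) (+ 4 ℤ.* + M ℤ.* + M ℤ.* + n))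
               (cong₂ ℤ._-_ (sym (pos-5n² n)) (sym (pos-A²+4M²n A M n))))
        refl
        (subst (λ z → NonNegSurd (+ 5 ℤ.* + n ℤ.* + n ℤ.- z ℤ.* z ℤ.- + 4 ℤ.* + M ℤ.* + M ℤ.* + n) (- (+ 4 ℤ.* + M ℤ.* z)) n)
               A≡ surd₂)
      bounds = nonNegSurd⇒ surd (-[4MA]≤0 M A)
      A²+4M²n≤ : A * A + 4 * M * M * n ≤ 5 * n * n
      A²+4M²n≤ = 0≤+m-+n⇒n≤m (proj₁ bounds)
      B = 5 * n * n ∸ (A * A + 4 * M * M * n)
      [4MA]²n≤B² : (4 * M * A) * (4 * M * A) * n ≤ B * B
      [4MA]²n≤B² = ℤ.drop‿+≤+ (subst₂ ℤ._≤_ (sym (pos-[4MA]²n M A n))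
        (trans (cong (λ z → z ℤ.* z) (+m-+n≡+[m∸n] A²+4M²n≤)) (sym (ℤ.pos-* B B))) (proj₂ bounds))

A²+4tn≡4t²+n² : ∀ {A n t} → A + n ≡ 2 * t → A * A + 4 * t * n ≡ 4 * (t * t) + n * n
A²+4tn≡4t²+n² {A} {n} {t} A+n≡2t = begin
  A * A + 4 * t * n         ≡⟨ solve 3 (λ A t n → A :* A :+ con 4 :* t :* n := A :* A :+ con 2 :* (con 2 :* t) :* n) refl A t n ⟩
  A * A + 2 * (2 * t) * n   ≡⟨ cong (λ z → A * A + 2 * z * n) A+n≡2t ⟨
  A * A + 2 * (A + n) * n   ≡⟨ solve 2 (λ A n → A :* A :+ con 2 :* (A :+ n) :* n := (A :+ n) :* (A :+ n) :+ n :* n) refl A n ⟩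
  (A + n) * (A + n) + n * n ≡⟨ cong (λ z → z * z + n * n) A+n≡2t ⟩
  2 * t * (2 * t) + n * n   ≡⟨ solve 2 (λ t n → (con 2 :* t) :* (con 2 :* t) :+ n :* n := con 4 :* (t :* t) :+ n :* n) refl t n ⟩
  4 * (t * t) + n * n       ∎
  where open ≡-Reasoning

-- Adding the two hypotheses to both sides leaves a ring identity.
≡-by-adding : ∀ L R {a₁ b₁ a₂ b₂} → a₁ ≡ b₁ → a₂ ≡ b₂ → L + (b₁ + b₂) ≡ R + (a₁ + a₂) → L ≡ R
≡-by-adding L R {a₁} {a₂ = a₂} refl refl e = +-cancelʳ-≡ (a₁ + a₂) L R e

goldenAbove⇒gapAbove : ∀ {M n t X} → GoldenAbove M n t →
  4 * M * M ≤ n → X * X ≤ M * M * (n * n * n) → 2 * X ≤ n * n → GapAbove n t X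
goldenAbove⇒gapAbove {M} {n} {t} {X} above 4M²≤n X²≤M²n³ 2X≤n² with goldenAbove⇒ {M} {n} {t} above
... | A , B , A+n≡2t , B+5n²≡ , [4MA]²n≤B² = *-cancelˡ-≤ 4 (≤-by-slack 0 4X+4M²n≤B
  (≡-by-adding _ _ B+5n²≡ (A²+4tn≡4t²+n² {A} {n} {t} A+n≡2t)
    (solve 6 (λ M n t A B X →
       con 4 :* (t :* n :+ n :* n :+ X) :+ B :+ con 0 :+ ((A :* A :+ con 4 :* M :* M :* n) :+ (con 4 :* (t :* t) :+ n :* n))
       := con 4 :* (t :* t) :+ (con 4 :* X :+ con 4 :* M :* M :* n) :+ ((B :+ con 5 :* n :* n) :+ (A :* A :+ con 4 :* t :* n)))
     refl M n t A B X)))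
  where
  2n≤A : 2 * n ≤ A
  2n≤A = m*m≤n*n⇒m≤n (≤-by-slack B (*-monoˡ-≤ n 4M²≤n)
    (trans (solve 2 (λ n B → con 2 :* n :* (con 2 :* n) :+ n :* n :+ B := B :+ con 5 :* n :* n) refl n B) B+5n²≡))
  [8Mn]²n≤B² : (4 * M * (2 * n)) * (4 * M * (2 * n)) * n ≤ B * B
  [8Mn]²n≤B² = ≤-trans (*-monoˡ-≤ n (*-mono-≤ (*-monoʳ-≤ (4 * M) 2n≤A) (*-monoʳ-≤ (4 * M) 2n≤A))) [4MA]²n≤B²
  4X+4M²n≤B : 4 * X + 4 * M * M * n ≤ B
  4X+4M²n≤B = m*m≤n*n⇒m≤n (≤-by-slack (28 * M * M * (n * n * n))
    (+-mono-≤ (+-mono-≤ (+-mono-≤ (*-monoʳ-≤ 16 X²≤M²n³) (*-monoʳ-≤ (16 * M * M * n) 2X≤n²)) (*-monoʳ-≤ (4 * M * M * n * n) 4M²≤n)) [8Mn]²n≤B²)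
    (solve 4 (λ M n X B →
       (con 4 :* X :+ con 4 :* M :* M :* n) :* (con 4 :* X :+ con 4 :* M :* M :* n)
         :+ (con 16 :* (M :* M :* (n :* n :* n)) :+ con 16 :* M :* M :* n :* (n :* n) :+ con 4 :* M :* M :* n :* n :* n :+ B :* B)
         :+ con 28 :* M :* M :* (n :* n :* n)
       := B :* B :+ (con 16 :* (X :* X) :+ con 16 :* M :* M :* n :* (con 2 :* X) :+ con 4 :* M :* M :* n :* n :* (con 4 :* M :* M)
         :+ (con 4 :* M :* (con 2 :* n)) :* (con 4 :* M :* (con 2 :* n)) :* n)) refl M n X B))

goldenBelow⇒gapBelow : ∀ {M n t X} → 1 ≤ n → n ≤ t → GoldenBelow M n t →
  X * X ≤ M * M * (n * n * n) → GapBelow n t X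
goldenBelow⇒gapBelow {M} {n} {t} {X} 1≤n n≤t below X²≤M²n³ with goldenBelow⇒ {M} {n} {t} 1≤n n≤t below
... | A , B , A+n≡2t , B+A²+4M²n≡5n² , [4MA]²n≤B² = *-cancelˡ-≤ 4 (≤-by-slack (4 * M * M * n) 4X≤B
  (≡-by-adding _ _ B+A²+4M²n≡5n² (sym (A²+4tn≡4t²+n² {A} {n} {t} A+n≡2t))
    (solve 6 (λ M n t A B X →
       con 4 :* (t :* t :+ X) :+ B :+ con 4 :* M :* M :* n :+ (con 5 :* n :* n :+ (A :* A :+ con 4 :* t :* n))
       := con 4 :* (n :* n :+ t :* n) :+ con 4 :* X :+ ((B :+ (A :* A :+ con 4 :* M :* M :* n)) :+ (con 4 :* (t :* t) :+ n :* n)))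
     refl M n t A B X)))
  where
  n≤A : n ≤ A
  n≤A = +-cancelʳ-≤ n n A (begin
    n + n       ≡⟨ cong (n +_) (+-identityʳ n) ⟨
    2 * n       ≤⟨ *-monoʳ-≤ 2 n≤t ⟩
    2 * t       ≡⟨ A+n≡2t ⟨
    A + n       ∎)
    where open ≤-Reasoning
  4X≤B : 4 * X ≤ B
  4X≤B = m*m≤n*n⇒m≤n (begin
    4 * X * (4 * X)                       ≡⟨ solve 1 (λ X → con 4 :* X :* (con 4 :* X) := con 16 :* (X :* X)) refl X ⟩
    16 * (X * X)                          ≤⟨ *-monoʳ-≤ 16 X²≤M²n³ ⟩
    16 * (M * M * (n * n * n))            ≡⟨ solve 2 (λ M n → con 16 :* (M :* M :* (n :* n :* n)) := con 4 :* M :* n :* (con 4 :* M :* n) :* n) refl M n ⟩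
    4 * M * n * (4 * M * n) * n           ≤⟨ *-monoˡ-≤ n (*-mono-≤ (*-monoʳ-≤ (4 * M) n≤A) (*-monoʳ-≤ (4 * M) n≤A)) ⟩
    4 * M * A * (4 * M * A) * n           ≤⟨ [4MA]²n≤B² ⟩
    B * B                                 ∎)
    where open ≤-Reasoning

-- Concentration

k*T≤[k+1]*G : ∀ k {T G B} → T ≤ G + B → k * B ≤ G → k * T ≤ suc k * G
k*T≤[k+1]*G k {T} {G} {B} T≤G+B kB≤G = begin
  k * T             ≤⟨ *-monoʳ-≤ k T≤G+B ⟩
  k * (G + B)       ≡⟨ *-distribˡ-+ k G B ⟩
  k * G + k * B     ≤⟨ +-monoʳ-≤ (k * G) kB≤G ⟩
  k * G + G         ≡⟨ +-comm (k * G) G ⟩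
  suc k * G         ∎
  where open ≤-Reasoning

module AboveThreshold (n′ q r : ℕ) (r≤1 : r ≤ 1) (k D : ℕ) (1≤D : 1 ≤ D) (D≤n : D ≤ suc n′)
             (2D≤a : 2 * D ≤ 2 * q + r) (D≤q+1 : D ≤ suc q) ([k+1]n≤D² : suc k * suc n′ ≤ D * D)
             (gap : GapAbove (suc n′) (suc n′ + (2 * q + r)) (24 * D * suc n′)) where

  open Classes n′ q r r≤1

  classSize-decay : ∀ j → q ≤ j + D → classSize (suc j) * (n + D) ≤ classSize j * n
  classSize-decay j q≤j+D = *-cancelʳ-≤ _ _ K {{>-nonZero 1≤K}} (begin
    classSize (suc j) * (n + D) * K   ≡⟨ *-CS.xy∙z≈xz∙y (classSize (suc j)) (n + D) K ⟩
    classSize (suc j) * K * (n + D)   ≡⟨ cong (_* (n + D)) (classSize-ratio j) ⟩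
    classSize j * E * (n + D)         ≡⟨ *-assoc (classSize j) E (n + D) ⟩
    classSize j * (E * (n + D))       ≤⟨ *-monoʳ-≤ (classSize j) (decay-ratio n D x w m 1≤x+D x≤w x+D≤m at-x) ⟩
    classSize j * (K * n)             ≡⟨ solve 3 (λ a b c → a :* (b :* c) := a :* c :* b) refl (classSize j) K n ⟩
    classSize j * n * K               ∎)
    where
    open ≤-Reasoning
    w = evensOf j
    m = halvesOf j
    K = suc w * suc (suc w) * suc m
    E = (n ∸ w) * (n ∸ suc w) * (m + n)
    1≤K : 1 ≤ K
    1≤K = *-mono-≤ (*-mono-≤ (s≤s (z≤n {w})) (s≤s (z≤n {suc w}))) (s≤s (z≤n {m}))
    x = a ∸ 2 * D
    x+2D≡a : x + 2 * D ≡ a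
    x+2D≡a = m∸n+n≡m 2D≤a
    1≤x+D = ≤-trans 1≤D (m≤n+m D x)
    x≤w : x ≤ w
    x≤w = +-cancelʳ-≤ (2 * D) x w (begin
      x + 2 * D        ≡⟨ x+2D≡a ⟩
      2 * q + r        ≤⟨ +-monoˡ-≤ r (*-monoʳ-≤ 2 q≤j+D) ⟩
      2 * (j + D) + r  ≡⟨ solve 3 (λ j D r → con 2 :* (j :+ D) :+ r := r :+ con 2 :* j :+ con 2 :* D) refl j D r ⟩
      w + 2 * D        ∎)
    x+D≤m : x + D ≤ m
    x+D≤m = +-cancelʳ-≤ D (x + D) m (begin
      x + D + D        ≡⟨ trans (+-assoc x D D) (cong (x +_) (cong (D +_) (sym (+-identityʳ D)))) ⟩
      x + 2 * D        ≡⟨ x+2D≡a ⟩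
      2 * q + r        ≤⟨ +-monoˡ-≤ r (+-monoʳ-≤ q (≤-trans (≤-reflexive (+-identityʳ q)) q≤j+D)) ⟩
      q + (j + D) + r  ≡⟨ solve 4 (λ q j D r → q :+ (j :+ D) :+ r := q :+ r :+ j :+ D) refl q j D r ⟩
      m + D            ∎)
    at-x = decay-threshold n D x D≤n (subst (λ s → GapAbove n s (24 * D * n)) (sym (trans (cong (_+ n) x+2D≡a) (+-comm a n))) gap)

  k*bad≤good : k * rangeSum classSize (suc q) n ≤ rangeSum classSize 0 (suc q)
  k*bad≤good = rangeSum-tail-≤ classSize k D q n D≤q+1
    (decay-shift classSize k n D [k+1]n≤D² (suc q ∸ D) (λ j s≤j → classSize-decay j (q≤j+D s≤j)))
    where
    q≤j+D : ∀ {j} → suc q ∸ D ≤ j → q ≤ j + D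
    q≤j+D {j} s≤j = begin
      q                 ≤⟨ n≤1+n q ⟩
      suc q             ≡⟨ m∸n+n≡m D≤q+1 ⟨
      suc q ∸ D + D     ≤⟨ +-monoˡ-≤ D s≤j ⟩
      j + D             ∎
      where open ≤-Reasoning

  probSolvableAtLeast : ProbSolvableAtLeast k n t
  probSolvableAtLeast = good , good-unique , LAll.tabulate good-solvable ,
    subst (λ g → k * total n t ≤ suc k * g) (sym length-good) (k*T≤[k+1]*G k total≤good+bad k*bad≤good)
    where
    good-solvable : ∀ {c} → c ∈ good → sum c ≡ t × CoverSolvable c
    good-solvable {c} c∈ with ∈-good⁻ c∈
    ... | sum≡t , evens≤a = sum≡t , Equivalence.from (coverSolvable⇔ c) (subst (n + evens c ≤_) (sym sum≡t) (+-monoʳ-≤ n evens≤a))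

module BelowThreshold (n′ q r : ℕ) (r≤1 : r ≤ 1) (k D : ℕ) (1≤D : 1 ≤ D) (D≤n : D ≤ suc n′)
             (a+2D≤n : 2 * q + r + 2 * D ≤ suc n′) ([k+1]n≤D² : suc k * suc n′ ≤ D * D)
             (gap : GapBelow (suc n′) (suc n′ + (2 * q + r)) (24 * D * suc n′)) where

  open Classes n′ q r r≤1

  classSize-growth : ∀ j → suc j ≤ q + D → classSize j * (n + D) ≤ classSize (suc j) * n
  classSize-growth j j<q+D = *-cancelʳ-≤ _ _ K {{>-nonZero 1≤K}} (begin
    classSize j * (n + D) * K         ≡⟨ *-assoc (classSize j) (n + D) K ⟩
    classSize j * ((n + D) * K)       ≡⟨ cong (classSize j *_) (*-comm (n + D) K) ⟩
    classSize j * (K * (n + D))       ≤⟨ *-monoʳ-≤ (classSize j) (growth-ratio n′ D w m (a + 2 * D) (a + D) t z<s w+2≤ m+1≤ t≤ at-a) ⟩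
    classSize j * (E * n)             ≡⟨ *-assoc (classSize j) E n ⟨
    classSize j * E * n               ≡⟨ cong (_* n) (classSize-ratio j) ⟨
    classSize (suc j) * K * n         ≡⟨ solve 3 (λ a b c → a :* b :* c := a :* c :* b) refl (classSize (suc j)) K n ⟩
    classSize (suc j) * n * K         ∎)
    where
    open ≤-Reasoning
    w = evensOf j
    m = halvesOf j
    K = suc w * suc (suc w) * suc m
    E = (n ∸ w) * (n ∸ suc w) * (m + n)
    1≤K : 1 ≤ K
    1≤K = *-mono-≤ (*-mono-≤ (s≤s (z≤n {w})) (s≤s (z≤n {suc w}))) (s≤s (z≤n {m}))
    w+2≤ : suc (suc w) ≤ a + 2 * D
    w+2≤ = begin
      2 + (r + 2 * j)       ≡⟨ solve 2 (λ r j → con 2 :+ (r :+ con 2 :* j) := con 2 :* (con 1 :+ j) :+ r) refl r j ⟩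
      2 * suc j + r         ≤⟨ +-monoˡ-≤ r (*-monoʳ-≤ 2 j<q+D) ⟩
      2 * (q + D) + r       ≡⟨ solve 3 (λ q D r → con 2 :* (q :+ D) :+ r := con 2 :* q :+ r :+ con 2 :* D) refl q D r ⟩
      a + 2 * D             ∎
    m+1≤ : suc m ≤ a + D
    m+1≤ = begin
      suc (q + r + j)       ≡⟨ solve 3 (λ q r j → con 1 :+ (q :+ r :+ j) := q :+ r :+ (con 1 :+ j)) refl q r j ⟩
      q + r + suc j         ≤⟨ +-monoʳ-≤ (q + r) j<q+D ⟩
      q + r + (q + D)       ≡⟨ solve 3 (λ q r D → q :+ r :+ (q :+ D) := con 2 :* q :+ r :+ D) refl q r D ⟩
      a + D                 ∎
    t≤ : t ≤ a + D + n′
    t≤ = begin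
      suc n′ + a            ≡⟨ solve 2 (λ n′ a → con 1 :+ n′ :+ a := a :+ con 1 :+ n′) refl n′ a ⟩
      a + 1 + n′            ≤⟨ +-monoˡ-≤ n′ (+-monoʳ-≤ a 1≤D) ⟩
      a + D + n′            ∎
    at-a = growth-threshold n D a a+2D≤n gap

  k*good≤bad : k * rangeSum classSize 0 (suc q) ≤ rangeSum classSize (suc q) n
  k*good≤bad = rangeSum-head-≤ classSize k D q n D≤n
    (λ i i≤q → growth-shift classSize k n D [k+1]n≤D² (q + D) classSize-growth i (+-monoˡ-≤ D i≤q))

  probSolvableAtMost : ProbSolvableAtMost k n t
  probSolvableAtMost = bad , bad-unique , LAll.tabulate bad-unsolvable ,
    subst (λ b → k * total n t ≤ suc k * b) (sym length-bad)
      (k*T≤[k+1]*G k (≤-trans total≤good+bad (≤-reflexive (+-comm (rangeSum classSize 0 (suc q)) _))) k*good≤bad)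
    where
    bad-unsolvable : ∀ {c} → c ∈ bad → sum c ≡ t × ¬ CoverSolvable c
    bad-unsolvable {c} c∈ with ∈-bad⁻ c∈
    ... | sum≡t , a<evens = sum≡t , λ solvable →
      <⇒≱ (subst (_< n + evens c) (sym sum≡t) (+-monoʳ-< n a<evens)) (Equivalence.to (coverSolvable⇔ c) solvable)

halve : ∀ a → ∃₂ λ q r → r ≤ 1 × 2 * q + r ≡ a
halve a with fromParityHalf-surjective a
... | inside , q , refl = q , 0 , z≤n , +-identityʳ (2 * q)
... | outside , q , refl = q , 1 , s≤s z≤n , +-comm (2 * q) 1

gapAbove⇒n+4D≤t : ∀ {n t D} → 1 ≤ n → D ≤ n → GapAbove n t (24 * D * n) → n + 4 * D ≤ t
gapAbove⇒n+4D≤t {n} {t} {D} 1≤n D≤n gap with n + 4 * D ≤? t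
... | yes n+4D≤t = n+4D≤t
... | no n+4D≰t = contradiction gap (<⇒≱ (begin-strict
  t * t                    ≤⟨ *-monoʳ-≤ t t≤n+4D ⟩
  t * (n + 4 * D)          ≡⟨ solve 3 (λ t n D → t :* (n :+ con 4 :* D) := t :* n :+ con 4 :* D :* t) refl t n D ⟩
  t * n + 4 * D * t        ≤⟨ +-monoʳ-≤ (t * n) (*-monoʳ-≤ (4 * D) (≤-trans t≤n+4D (+-monoʳ-≤ n (*-monoʳ-≤ 4 D≤n)))) ⟩
  t * n + 4 * D * (n + 4 * n) ≡⟨ solve 3 (λ t n D → t :* n :+ con 4 :* D :* (n :+ con 4 :* n) := t :* n :+ con 20 :* D :* n) refl t n D ⟩
  t * n + 20 * D * n       ≤⟨ +-monoʳ-≤ (t * n) (*-monoˡ-≤ n (*-monoˡ-≤ D (m≤n+m 20 4))) ⟩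
  t * n + 24 * D * n       <⟨ +-monoˡ-< (24 * D * n) (m<m+n (t * n) (*-mono-≤ 1≤n 1≤n)) ⟩
  t * n + n * n + 24 * D * n ∎))
  where
  open ≤-Reasoning
  t≤n+4D : t ≤ n + 4 * D
  t≤n+4D = <⇒≤ (≰⇒> n+4D≰t)

4D≤2q+r⇒D≤q+1 : ∀ {q r D} → r ≤ 1 → 4 * D ≤ 2 * q + r → D ≤ suc q
4D≤2q+r⇒D≤q+1 {q} {r} {D} r≤1 4D≤a = *-cancelˡ-≤ 4 (begin
  4 * D           ≤⟨ 4D≤a ⟩
  2 * q + r       ≤⟨ +-mono-≤ (*-monoˡ-≤ q (m≤m+n 2 2)) (≤-trans r≤1 (m≤m+n 1 3)) ⟩
  4 * q + 4       ≡⟨ solve 1 (λ q → con 4 :* q :+ con 4 := con 4 :* (con 1 :+ q)) refl q ⟩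
  4 * suc q       ∎)
  where open ≤-Reasoning

gapBelow⇒a+24D≤n : ∀ {n a D} .{{_ : NonZero n}} → GapBelow n (n + a) (24 * D * n) → a + 24 * D ≤ n
gapBelow⇒a+24D≤n {n} {a} {D} gap = *-cancelˡ-≤ n (≤-by-slack (a * a) gap
  (solve 3 (λ n a D → n :* (a :+ con 24 :* D) :+ (n :* n :+ (n :+ a) :* n) :+ a :* a
                    := n :* n :+ ((n :+ a) :* (n :+ a) :+ con 24 :* D :* n)) refl n a D))

-- D ≈ √((k + 1) n) is the shift along the classes that gains the factor k + 1, and M = 48 (k + 1)
-- makes the golden-ratio margin M √n exceed the slack 24 D n needed by the ratio bounds.
record Scale (k n : ℕ) : Set where
  field
    D : ℕ
    1≤D : 1 ≤ D
    [k+1]n≤D² : suc k * n ≤ D * D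
    48D≤n : 48 * D ≤ n
    X²≤M²n³ : (24 * D * n) * (24 * D * n) ≤ (48 * suc k) * (48 * suc k) * (n * n * n)

module _ (k n′ : ℕ) (4M²≤n : 4 * (48 * suc k) * (48 * suc k) ≤ suc n′) where

  private
    n = suc n′

    k+1≤[k+1]² : suc k ≤ suc k * suc k
    k+1≤[k+1]² = m≤m*n (suc k) (suc k)

  golden-scale : Scale k n
  golden-scale with sqrt-bracket (n′ + k * n)
  ... | D , 1≤D , [k+1]n≤D² , D²≤4[k+1]n = record
    { D = D ; 1≤D = 1≤D ; [k+1]n≤D² = [k+1]n≤D² ; 48D≤n = 48D≤n ; X²≤M²n³ = X²≤M²n³ }
    where
    open ≤-Reasoning
    48D≤n : 48 * D ≤ n
    48D≤n = m*m≤n*n⇒m≤n (begin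
      48 * D * (48 * D)              ≡⟨ solve 1 (λ D → con 48 :* D :* (con 48 :* D) := con 2304 :* (D :* D)) refl D ⟩
      2304 * (D * D)                 ≤⟨ *-monoʳ-≤ 2304 D²≤4[k+1]n ⟩
      2304 * (4 * (suc k * n))       ≡⟨ solve 2 (λ K n → con 2304 :* (con 4 :* (K :* n)) := con 9216 :* K :* n) refl (suc k) n ⟩
      9216 * suc k * n               ≤⟨ *-monoˡ-≤ n (*-monoʳ-≤ 9216 k+1≤[k+1]²) ⟩
      9216 * (suc k * suc k) * n     ≡⟨ solve 2 (λ K n → con 9216 :* (K :* K) :* n := con 4 :* (con 48 :* K) :* (con 48 :* K) :* n) refl (suc k) n ⟩
      4 * (48 * suc k) * (48 * suc k) * n                  ≤⟨ *-monoˡ-≤ n 4M²≤n ⟩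
      n * n                          ∎)
    X²≤M²n³ : (24 * D * n) * (24 * D * n) ≤ (48 * suc k) * (48 * suc k) * (n * n * n)
    X²≤M²n³ = begin
      24 * D * n * (24 * D * n)           ≡⟨ solve 2 (λ D n → con 24 :* D :* n :* (con 24 :* D :* n) := con 576 :* (D :* D) :* (n :* n)) refl D n ⟩
      576 * (D * D) * (n * n)             ≤⟨ *-monoˡ-≤ (n * n) (*-monoʳ-≤ 576 D²≤4[k+1]n) ⟩
      576 * (4 * (suc k * n)) * (n * n)   ≡⟨ solve 2 (λ K n → con 576 :* (con 4 :* (K :* n)) :* (n :* n) := con 2304 :* K :* (n :* n :* n)) refl (suc k) n ⟩
      2304 * suc k * (n * n * n)          ≤⟨ *-monoˡ-≤ (n * n * n) (*-monoʳ-≤ 2304 k+1≤[k+1]²) ⟩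
      2304 * (suc k * suc k) * (n * n * n) ≡⟨ solve 2 (λ K n → con 2304 :* (K :* K) :* (n :* n :* n) := con 48 :* K :* (con 48 :* K) :* (n :* n :* n)) refl (suc k) n ⟩
      (48 * suc k) * (48 * suc k) * (n * n * n)                 ∎

  probSolvableAtMost-few : ∀ {t} → t < n → ProbSolvableAtMost k n t
  probSolvableAtMost-few {t} t<n = compositions n t , compositions-unique n t , LAll.tabulate unsolvable ,
    subst (λ T → k * T ≤ suc k * length (compositions n t)) (length-compositions n′ t) (m≤n+m _ _)
    where
    unsolvable : ∀ {c} → c ∈ compositions n t → sum c ≡ t × ¬ CoverSolvable c
    unsolvable {c} c∈ = ∈-compositions⁻ n t c∈ , λ solvable →
      <⇒≱ (subst (_< n + evens c) (sym (∈-compositions⁻ n t c∈)) (<-≤-trans t<n (m≤m+n n (evens c))))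
          (Equivalence.to (coverSolvable⇔ c) solvable)

  probSolvableAtLeast-golden : ∀ t → GoldenAbove (48 * suc k) n t → ProbSolvableAtLeast k n t
  probSolvableAtLeast-golden t above with halve (t ∸ n)
  ... | q , r , r≤1 , 2q+r≡t∸n =
    subst (ProbSolvableAtLeast k n) n+a≡t
      (AboveThreshold.probSolvableAtLeast n′ q r r≤1 k D 1≤D D≤n 2D≤a (4D≤2q+r⇒D≤q+1 r≤1 4D≤a) [k+1]n≤D²
        (subst (λ s → GapAbove n s (24 * D * n)) (sym n+a≡t) gap))
    where
    open Scale golden-scale
    D≤n = ≤-trans (m≤n*m D 48) 48D≤n
    gap : GapAbove n t (24 * D * n)
    gap = goldenAbove⇒gapAbove {(48 * suc k)} {n} {t} above 4M²≤n X²≤M²n³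
            (≤-trans (≤-reflexive (solve 2 (λ D n → con 2 :* (con 24 :* D :* n) := con 48 :* D :* n) refl D n)) (*-monoˡ-≤ n 48D≤n))
    n+4D≤t = gapAbove⇒n+4D≤t z<s D≤n gap
    n+a≡t : n + (2 * q + r) ≡ t
    n+a≡t = trans (cong (n +_) 2q+r≡t∸n) (m+[n∸m]≡n (≤-trans (m≤m+n n (4 * D)) n+4D≤t))
    4D≤a : 4 * D ≤ 2 * q + r
    4D≤a = +-cancelˡ-≤ n _ _ (subst (n + 4 * D ≤_) (sym n+a≡t) n+4D≤t)
    2D≤a = ≤-trans (*-monoˡ-≤ D (m≤m+n 2 2)) 4D≤a

  probSolvableAtMost-golden : ∀ t → GoldenBelow (48 * suc k) n t → ProbSolvableAtMost k n t
  probSolvableAtMost-golden t below with n ≤? t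
  ... | no n≰t = probSolvableAtMost-few (≰⇒> n≰t)
  ... | yes n≤t with halve (t ∸ n)
  ...   | q , r , r≤1 , 2q+r≡t∸n =
    subst (ProbSolvableAtMost k n) n+a≡t
      (BelowThreshold.probSolvableAtMost n′ q r r≤1 k D 1≤D D≤n a+2D≤n [k+1]n≤D² gap)
    where
    open Scale golden-scale
    D≤n = ≤-trans (m≤n*m D 48) 48D≤n
    n+a≡t : n + (2 * q + r) ≡ t
    n+a≡t = trans (cong (n +_) 2q+r≡t∸n) (m+[n∸m]≡n n≤t)
    gap : GapBelow n (n + (2 * q + r)) (24 * D * n)
    gap = subst (λ s → GapBelow n s (24 * D * n)) (sym n+a≡t) (goldenBelow⇒gapBelow {(48 * suc k)} {n} {t} z<s n≤t below X²≤M²n³)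
    a+2D≤n = ≤-trans (+-monoʳ-≤ (2 * q + r) (*-monoˡ-≤ D (m≤m+n 2 22))) (gapBelow⇒a+24D≤n {n} {2 * q + r} {D} gap)

eventually : ∀ {P Q : ℕ → Set} {N₀} → (∃ λ N → ∀ n → N ≤ n → P n) → (∀ n → N₀ ≤ n → P n → Q n) →
             ∃ λ N → ∀ n → N ≤ n → Q n
eventually {N₀ = N₀} (N , P-from-N) P⇒Q =
  N + N₀ , λ n N+N₀≤n → P⇒Q n (≤-trans (m≤n+m N₀ N) N+N₀≤n) (P-from-N n (≤-trans (m≤m+n N N₀) N+N₀≤n))

theorem6 :
  ((t : ℕ → ℕ) →
    (∀ M → ∃ λ N → ∀ n → N ≤ n → GoldenAbove M n (t n)) →
    ∀ k → ∃ λ N → ∀ n → N ≤ n → ProbSolvableAtLeast k n (t n))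
  ×
  ((t : ℕ → ℕ) →
    (∀ M → ∃ λ N → ∀ n → N ≤ n → GoldenBelow M n (t n)) →
    ∀ k → ∃ λ N → ∀ n → N ≤ n → ProbSolvableAtMost k n (t n))
theorem6 = (λ t above k → eventually (above (48 * suc k)) (solvable k t))
         , (λ t below k → eventually (below (48 * suc k)) (unsolvable k t))
  where
  solvable : ∀ k (t : ℕ → ℕ) n → 4 * (48 * suc k) * (48 * suc k) ≤ n →
             GoldenAbove (48 * suc k) n (t n) → ProbSolvableAtLeast k n (t n)
  solvable k t zero ()
  solvable k t (suc n′) 4M²≤n = probSolvableAtLeast-golden k n′ 4M²≤n (t (suc n′))
  unsolvable : ∀ k (t : ℕ → ℕ) n → 4 * (48 * suc k) * (48 * suc k) ≤ n →
               GoldenBelow (48 * suc k) n (t n) → ProbSolvableAtMost k n (t n)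
  unsolvable k t zero ()
  unsolvable k t (suc n′) 4M²≤n = probSolvableAtMost-golden k n′ 4M²≤n (t (suc n′))
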